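{- Let $n\ge0$, $\mathbf{x}=(x_1,\dots,x_n)$, $z$ a single variable, and $\lambda=(\lambda_1,\dots,\lambda_{n+1})$ a partition (trailing zeros allowed). Then the odd symplectic character satisfies the Jacobi–Trudi identity $$sp_\lambda(\mathbf{x}^{\pm};z)=\det\big(h_{\lambda_i-i+j}(\mathbf{x}^{\pm};z)+\delta_{j>1}h_{\lambda_i-i-j+2}(\mathbf{x}^{\pm};z)\big)_{i,j=1}^{n+1}.$$
   Context: The odd symplectic character is $sp_\lambda(\mathbf{x}^{\pm};z)=\det(a_{ij})_{i,j=1}^{n+1}/\det(b_{ij})_{i,j=1}^{n+1}$ with $a_{ij}=x_i^{\lambda_j+n-j+2}-x_i^{ -\lambda_j-(n-j+2)}-z^{ -1}\big(x_i^{\lambda_j+n-j+1}-x_i^{ -\lambda_j-(n-j+1)}\big)$ for $1\le i\le n$, $a_{n+1,j}=z^{\lambda_j+n-j+2}-z^{\lambda_j+n-j}$, $b_{ij}=x_i^{n-j+2}-x_i^{ -(n-j+2)}$ for $1\le i\le n$, $b_{n+1,j}=z^{n-j+2}-z^{ -(n-j+2)}$. The $h_i(\mathbf{x}^{\pm};z)$ are defined by $\frac{1}{1-zw}\prod_{i=1}^n\frac{1}{(1-x_iw)(1-x_i^{ -1}w)}=\sum_{i\in\mathbb{Z}}h_i(\mathbf{x}^{\pm};z)w^i$ (so $h_i=0$ for $i<0$). $\delta_{j>1}$ is $1$ if $j>1$, else $0$. -}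

module Defs where

open import Level using (Level)
open import Algebra.Bundles using (CommutativeRing)
open import Data.Nat as ℕ using (ℕ; zero; suc; _∸_)
open import Data.Integer as ℤ using (ℤ; +_; -[1+_])
open import Data.Fin as Fin using (Fin; zero; suc; toℕ; punchIn)
open import Data.List using (List; []; _∷_)

IsPartition : ∀ {m} → (Fin m → ℕ) → Set
IsPartition {m} la = ∀ (i j : Fin m) → i Fin.≤ j → la j ℕ.≤ la i

module WithRing {c ℓ : Level} (R : CommutativeRing c ℓ) where
  open CommutativeRing R using (Carrier; _+_; _*_; -_; _-_; 0#; 1#)

  sumF : ∀ {m} → (Fin m → Carrier) → Carrier
  sumF {zero}  f = 0#
  sumF {suc m} f = f zero + sumF (λ i → f (suc i))

  pow : Carrier → ℕ → Carrier
  pow y zero    = 1#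
  pow y (suc k) = y * pow y k

  ipow : Carrier → Carrier → ℤ → Carrier
  ipow y yinv (+ k)      = pow y k
  ipow y yinv -[1+ k ]   = pow yinv (suc k)

  alt : ℕ → Carrier → Carrier
  alt zero    a = a
  alt (suc k) a = - alt k a

  det : ∀ {m} → (Fin m → Fin m → Carrier) → Carrier
  det {zero}  M = 1#
  det {suc m} M = sumF (λ j → alt (toℕ j) (M zero j * det (λ r s → M (suc r) (punchIn j s))))

  -- complete homogeneous symmetric polynomial h_k(y_1,...,y_r), i.e. the
  -- coefficient of w^k in  ∏_a 1/(1 - y_a w)
  hh : List Carrier → ℕ → Carrier
  hh []       zero    = 1#
  hh []       (suc k) = 0#
  hh (y ∷ ys) k       = sumF {suc k} (λ j → pow y (toℕ j) * hh ys (k ∸ toℕ j))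

  vars : ∀ {n} → (Fin n → Carrier) → (Fin n → Carrier) → Carrier → List Carrier
  vars {zero}  x xinv z = z ∷ []
  vars {suc n} x xinv z = x zero ∷ xinv zero ∷ vars (λ i → x (suc i)) (λ i → xinv (suc i)) z

  -- h_k(x^±; z) for k ∈ ℤ (zero for k < 0): coefficient of w^k in
  -- 1/(1 - z w) ∏_i 1/((1 - x_i w)(1 - x_i^{-1} w))
  hZ : ∀ {n} → (Fin n → Carrier) → (Fin n → Carrier) → Carrier → ℤ → Carrier
  hZ x xinv z (+ k)    = hh (vars x xinv z) k
  hZ x xinv z -[1+ k ] = 0#

  -- Numerator matrix (a_ij), 0-indexed: i, j ∈ Fin (n+1).
  -- With 1-indexed j, λ_j + n - j + 2 = la j' + (n - j') + 1 where j' = j - 1.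
  matA : (n : ℕ) → (Fin n → Carrier) → (Fin n → Carrier) → Carrier → Carrier
       → (Fin (suc n) → ℕ) → Fin (suc n) → Fin (suc n) → Carrier
  matA n x xinv z zinv la i j = row (Fin.toℕ i ℕ.<? n) i
    where
      open import Relation.Nullary using (yes; no)
      e : ℕ
      e = la j ℕ.+ (n ∸ toℕ j) ℕ.+ 1
      row : _ → Fin (suc n) → Carrier
      row (yes p) i = let xi = x (Fin.fromℕ< p) ; xiv = xinv (Fin.fromℕ< p) in
        (ipow xi xiv (+ e) - ipow xi xiv (ℤ.- (+ e)))
        - (zinv * (ipow xi xiv (+ e ℤ.- + 1) - ipow xi xiv (ℤ.- (+ e ℤ.- + 1))))
      row (no _)  i = ipow z zinv (+ e) - ipow z zinv (+ e ℤ.- + 2)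

  -- Denominator matrix (b_ij), 0-indexed; n - j + 2 = (n - j') + 1.
  matB : (n : ℕ) → (Fin n → Carrier) → (Fin n → Carrier) → Carrier → Carrier
       → Fin (suc n) → Fin (suc n) → Carrier
  matB n x xinv z zinv i j = row (Fin.toℕ i ℕ.<? n) i
    where
      open import Relation.Nullary using (yes; no)
      e : ℕ
      e = (n ∸ toℕ j) ℕ.+ 1
      row : _ → Fin (suc n) → Carrier
      row (yes p) i = let xi = x (Fin.fromℕ< p) ; xiv = xinv (Fin.fromℕ< p) in
        ipow xi xiv (+ e) - ipow xi xiv (ℤ.- (+ e))
      row (no _)  i = ipow z zinv (+ e) - ipow z zinv (ℤ.- (+ e))

  -- Jacobi–Trudi matrix, 0-indexed (i' = i-1, j' = j-1):
  -- h_{λ_i - i + j} + δ_{j>1} h_{λ_i - i - j + 2}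
  --   = h_{la i' - i' + j'} + [j' > 0] h_{la i' - i' - j'}
  matJT : (n : ℕ) → (Fin n → Carrier) → (Fin n → Carrier) → Carrier
        → (Fin (suc n) → ℕ) → Fin (suc n) → Fin (suc n) → Carrier
  matJT n x xinv z la i zero    = hZ x xinv z (+ la i ℤ.- + toℕ i)
  matJT n x xinv z la i (suc j) =
    hZ x xinv z (+ la i ℤ.- + toℕ i ℤ.+ + toℕ (suc j))
    + hZ x xinv z (+ la i ℤ.- + toℕ i ℤ.- + toℕ (suc j))

{-# OPTIONS --safe #-}
module Submission where

-- Write h_p for hZ and c_k(p) for h_{p+k} + h_{p-k} (c_0 = h), so that the
-- Jacobi–Trudi matrix is (c_j(λ_i - i))_{i,j}.  On generating functions,
-- T_t φ(p) = φ(p+1) + φ(p-1) - t φ(p) multiplies by w + w⁻¹ - t, which for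
-- t = a + a⁻¹ equals w⁻¹ (1 - a w)(1 - a⁻¹ w) and so cancels the pair
-- a^{±1} from ∏ 1/(1 - y w); it also maps span(c_0,…,c_N) into
-- span(c_0,…,c_{N+1}) with coefficients independent of p.  Applying n such
-- operators to h that cancel all variables except one pair x_r^{±1} (or
-- except z) yields, up to a scalar, the p-th entry of row r of the numerator
-- (a_ij) at p = λ_j - j.  Hence (a_ij) = C · (Jacobi–Trudi)ᵀ for a matrix C
-- not depending on λ, and det C = det (b_ij) by specialising to λ = 0,
-- where the Jacobi–Trudi matrix is unitriangular and (a_ij) = (b_ij) U with
-- U unitriangular.

open import Defs
open import Level using (_⊔_)
open import Algebra.Bundles using (CommutativeRing; RawRing)
open import Data.Nat as ℕ using (ℕ; zero; suc; z≤n; s≤s)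
import Data.Nat.Properties as ℕₚ
open import Data.Integer as ℤ using (ℤ; +_; -[1+_])
import Data.Integer.Properties as ℤₚ
open import Data.Fin as Fin using (Fin; zero; suc; toℕ; punchIn; punchOut; inject₁)
open import Data.Fin.Properties
  using (toℕ<n; toℕ-injective; suc-injective; punchInᵢ≢i; punchIn-injective; punchIn-punchOut)
import Data.Vec.Functional as V
open import Data.List using (List; []; _∷_; length)
open import Data.Maybe using (Maybe; just; nothing)
open import Data.Product using (Σ; _×_; _,_; proj₁; proj₂)
open import Data.Sum using (_⊎_; inj₁; inj₂)
open import Data.Sign as Sign using (Sign)
open import Data.Empty using (⊥-elim)
open import Data.Unit.Polymorphic using (⊤)
open import Induction.WellFounded using (Acc; acc)
open import Data.Nat.Induction using (<-wellFounded)
open import Relation.Nullary using (¬_; yes; no)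
open import Relation.Binary.PropositionalEquality as P using (_≡_)

module IntegerCoefficientSolver {c ℓ} (R : CommutativeRing c ℓ) where
  open CommutativeRing R hiding (zero)
  open import Relation.Binary.Reasoning.Setoid setoid
  open import Algebra.Properties.Ring ring using (-‿distribˡ-*; -‿distribʳ-*)
  open import Algebra.Properties.Group +-group using (⁻¹-involutive; ε⁻¹≈ε)
  open import Algebra.Properties.AbelianGroup +-abelianGroup using (⁻¹-∙-comm)
  open import Algebra.Properties.Semiring.Mult semiring using (×-homo-+; ×1-homo-*) renaming (_×_ to _×ₙ_)
  import Algebra.Solver.Ring.AlmostCommutativeRing as ACR

  fromℕ : ℕ → Carrier
  fromℕ n = n ×ₙ 1#

  fromℤ : ℤ → Carrier
  fromℤ (+ n)    = fromℕ n
  fromℤ -[1+ n ] = - fromℕ (suc n)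

  private
    1+-‿1+ : ∀ a b → (1# + a) - (1# + b) ≈ a - b
    1+-‿1+ a b = begin
      (1# + a) - (1# + b)     ≈⟨ +-congˡ (-‿cong (+-comm 1# b)) ⟩
      (1# + a) + - (b + 1#)   ≈⟨ +-congˡ (⁻¹-∙-comm b 1#) ⟨
      (1# + a) + (- b + - 1#) ≈⟨ +-congˡ (+-comm (- b) (- 1#)) ⟩
      (1# + a) + (- 1# + - b) ≈⟨ +-assoc 1# a _ ⟩
      1# + (a + (- 1# + - b)) ≈⟨ +-congˡ (+-assoc a (- 1#) (- b)) ⟨
      1# + ((a + - 1#) + - b) ≈⟨ +-congˡ (+-congʳ (+-comm a (- 1#))) ⟩
      1# + ((- 1# + a) + - b) ≈⟨ +-congˡ (+-assoc (- 1#) a (- b)) ⟩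
      1# + (- 1# + (a - b))   ≈⟨ +-assoc 1# (- 1#) _ ⟨
      (1# + - 1#) + (a - b)   ≈⟨ +-congʳ (-‿inverseʳ 1#) ⟩
      0# + (a - b)            ≈⟨ +-identityˡ _ ⟩
      a - b                   ∎

    fromℤ-⊖ : ∀ m n → fromℤ (m ℤ.⊖ n) ≈ fromℕ m - fromℕ n
    fromℤ-⊖ m       zero    = sym (trans (+-congˡ ε⁻¹≈ε) (+-identityʳ _))
    fromℤ-⊖ zero    (suc n) = sym (+-identityˡ _)
    fromℤ-⊖ (suc m) (suc n) = begin
      fromℤ (suc m ℤ.⊖ suc n)       ≡⟨ P.cong fromℤ (ℤₚ.[1+m]⊖[1+n]≡m⊖n m n) ⟩
      fromℤ (m ℤ.⊖ n)               ≈⟨ fromℤ-⊖ m n ⟩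
      fromℕ m - fromℕ n             ≈⟨ 1+-‿1+ _ _ ⟨
      fromℕ (suc m) - fromℕ (suc n) ∎

    fromℤ-+ : ∀ i j → fromℤ (i ℤ.+ j) ≈ fromℤ i + fromℤ j
    fromℤ-+ (+ m)    (+ n)    = ×-homo-+ 1# m n
    fromℤ-+ (+ m)    -[1+ n ] = fromℤ-⊖ m (suc n)
    fromℤ-+ -[1+ m ] (+ n)    = trans (fromℤ-⊖ n (suc m)) (+-comm (fromℕ n) _)
    fromℤ-+ -[1+ m ] -[1+ n ] = begin
      - fromℕ (suc (suc (m ℕ.+ n)))  ≡⟨ P.cong (λ k → - fromℕ (suc k)) (ℕₚ.+-suc m n) ⟨
      - fromℕ (suc m ℕ.+ suc n)      ≈⟨ -‿cong (×-homo-+ 1# (suc m) (suc n)) ⟩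
      - (fromℕ (suc m) + fromℕ (suc n)) ≈⟨ ⁻¹-∙-comm _ _ ⟨
      - fromℕ (suc m) + - fromℕ (suc n) ∎

    signed : Sign → Carrier → Carrier
    signed Sign.+ a = a
    signed Sign.- a = - a

    signed-cong : ∀ s {a b} → a ≈ b → signed s a ≈ signed s b
    signed-cong Sign.+ e = e
    signed-cong Sign.- e = -‿cong e

    signed-* : ∀ s t a b → signed (s Sign.* t) (a * b) ≈ signed s a * signed t b
    signed-* Sign.+ Sign.+ a b = refl
    signed-* Sign.+ Sign.- a b = -‿distribʳ-* a b
    signed-* Sign.- Sign.+ a b = -‿distribˡ-* a b
    signed-* Sign.- Sign.- a b = begin
      a * b         ≈⟨ ⁻¹-involutive _ ⟨
      - - (a * b)   ≈⟨ -‿cong (-‿distribˡ-* a b) ⟩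
      - (- a * b)   ≈⟨ -‿distribʳ-* (- a) b ⟩
      - a * - b     ∎

    fromℤ-◃ : ∀ s n → fromℤ (s ℤ.◃ n) ≈ signed s (fromℕ n)
    fromℤ-◃ Sign.+ zero    = refl
    fromℤ-◃ Sign.- zero    = sym ε⁻¹≈ε
    fromℤ-◃ Sign.+ (suc n) = refl
    fromℤ-◃ Sign.- (suc n) = refl

    fromℤ-signAbs : ∀ i → fromℤ i ≈ signed (ℤ.sign i) (fromℕ ℤ.∣ i ∣)
    fromℤ-signAbs (+ n)    = refl
    fromℤ-signAbs -[1+ n ] = refl

    fromℤ-* : ∀ i j → fromℤ (i ℤ.* j) ≈ fromℤ i * fromℤ j
    fromℤ-* i j = begin
      fromℤ (i ℤ.* j)                          ≈⟨ fromℤ-◃ s (ℤ.∣ i ∣ ℕ.* ℤ.∣ j ∣) ⟩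
      signed s (fromℕ (ℤ.∣ i ∣ ℕ.* ℤ.∣ j ∣))   ≈⟨ signed-cong s (×1-homo-* ℤ.∣ i ∣ ℤ.∣ j ∣) ⟩
      signed s (fromℕ ℤ.∣ i ∣ * fromℕ ℤ.∣ j ∣) ≈⟨ signed-* (ℤ.sign i) (ℤ.sign j) _ _ ⟩
      signed (ℤ.sign i) (fromℕ ℤ.∣ i ∣) * signed (ℤ.sign j) (fromℕ ℤ.∣ j ∣)
                                               ≈⟨ *-cong (fromℤ-signAbs i) (fromℤ-signAbs j) ⟨
      fromℤ i * fromℤ j                        ∎
      where s = ℤ.sign i Sign.* ℤ.sign j

    fromℤ-neg : ∀ i → fromℤ (ℤ.- i) ≈ - fromℤ i
    fromℤ-neg (+ zero)  = sym ε⁻¹≈ε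
    fromℤ-neg (+ suc n) = refl
    fromℤ-neg -[1+ n ]  = sym (⁻¹-involutive _)

    ℤ-rawRing : RawRing _ _
    ℤ-rawRing = record
      { Carrier = ℤ ; _≈_ = _≡_ ; _+_ = ℤ._+_ ; _*_ = ℤ._*_ ; -_ = ℤ.-_ ; 0# = + 0 ; 1# = + 1 }

    fromℤ-morphism : ℤ-rawRing ACR.-Raw-AlmostCommutative⟶ ACR.fromCommutativeRing R
    fromℤ-morphism = record
      { ⟦_⟧ = fromℤ ; +-homo = fromℤ-+ ; *-homo = fromℤ-* ; -‿homo = fromℤ-neg
      ; 0-homo = refl ; 1-homo = +-identityʳ 1# }

    fromℤ-≟ : ∀ i j → Maybe (fromℤ i ≈ fromℤ j)
    fromℤ-≟ i j with i ℤ.≟ j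
    ... | yes P.refl = just refl
    ... | no _       = nothing

  open import Algebra.Solver.Ring ℤ-rawRing (ACR.fromCommutativeRing R) fromℤ-morphism fromℤ-≟ public
    using (solve; _:+_; _:*_; :-_; _:-_; _:=_; con)

module IndexArithmetic where
  import Data.Integer.Tactic.RingSolver as ℤ-Solver
  import Data.Nat.Tactic.RingSolver as ℕ-Solver

  p+1-1≡p : ∀ p → p ℤ.+ + 1 ℤ.- + 1 ≡ p
  p+1-1≡p = ℤ-Solver.solve-∀

  p+1-1-1≡p-1 : ∀ p → p ℤ.+ + 1 ℤ.- + 1 ℤ.- + 1 ≡ p ℤ.- + 1
  p+1-1-1≡p-1 = ℤ-Solver.solve-∀

  p-1+s≡p+s-1 : ∀ p s → p ℤ.- + 1 ℤ.+ s ≡ p ℤ.+ s ℤ.- + 1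
  p-1+s≡p+s-1 = ℤ-Solver.solve-∀

  private
    a-b+[c+b]≡a+c : ∀ a b c → a ℤ.- b ℤ.+ (c ℤ.+ b) ≡ a ℤ.+ c
    a-b+[c+b]≡a+c = ℤ-Solver.solve-∀

    0-b+b≡0 : ∀ b → + 0 ℤ.- b ℤ.+ b ≡ + 0
    0-b+b≡0 = ℤ-Solver.solve-∀

  l-t+n≡l+[n∸t] : ∀ l t n → t ℕ.≤ n → + l ℤ.- + t ℤ.+ + n ≡ + (l ℕ.+ (n ℕ.∸ t))
  l-t+n≡l+[n∸t] l t n t≤n =
    P.trans (P.cong (λ q → + l ℤ.- + t ℤ.+ + q) (P.sym (ℕₚ.m∸n+n≡m t≤n)))
            (a-b+[c+b]≡a+c (+ l) (+ t) (+ (n ℕ.∸ t)))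

  -t+t≡0 : ∀ t → + 0 ℤ.- + t ℤ.+ + t ≡ + 0
  -t+t≡0 t = 0-b+b≡0 (+ t)

  s<t⇒-t+s<0 : ∀ s t → s ℕ.< t → Σ ℕ λ u → + 0 ℤ.- + t ℤ.+ + s ≡ -[1+ u ]
  s<t⇒-t+s<0 s t s<t with t ℕ.∸ s | ℕₚ.m+[n∸m]≡n (ℕₚ.<⇒≤ s<t) | ℤₚ.⊖-< s<t
  ... | zero  | e | _  = ⊥-elim (ℕₚ.<⇒≢ s<t (P.trans (P.sym (ℕₚ.+-identityʳ s)) e))
  ... | suc u | _ | e′ =
    u , P.trans (P.cong (ℤ._+ + s) (ℤₚ.+-identityˡ (ℤ.- + t))) (P.trans (ℤₚ.-m+n≡n⊖m t s) e′)

  rotate : ∀ w x y z → w ℕ.+ (x ℕ.+ (y ℕ.+ z)) ≡ x ℕ.+ (y ℕ.+ (w ℕ.+ z))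
  rotate = ℕ-Solver.solve-∀

  rearrangementGain : ∀ D B t S → D ℕ.* (suc B ℕ.+ t) ℕ.+ (suc D ℕ.* B ℕ.+ S) ℕ.+ suc t
                                  ≡ D ℕ.* B ℕ.+ (suc D ℕ.* (suc B ℕ.+ t) ℕ.+ S)
  rearrangementGain = ℕ-Solver.solve-∀

module _ {c ℓ} (R : CommutativeRing c ℓ) where
  open CommutativeRing R hiding (zero)
  open WithRing R
  open IntegerCoefficientSolver R
  open import Relation.Binary.Reasoning.Setoid setoid
  open import Algebra.Properties.Ring ring using (-‿distribˡ-*; -‿distribʳ-*)

  ≡⇒≈ : ∀ {a b} → a ≡ b → a ≈ b
  ≡⇒≈ P.refl = refl

  sumF-cong : ∀ {m} {f g : Fin m → Carrier} → (∀ i → f i ≈ g i) → sumF f ≈ sumF g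
  sumF-cong {zero}  e = refl
  sumF-cong {suc m} e = +-cong (e zero) (sumF-cong (λ i → e (suc i)))

  sumF-+ : ∀ {m} (f g : Fin m → Carrier) → sumF (λ i → f i + g i) ≈ sumF f + sumF g
  sumF-+ {zero}  f g = sym (+-identityʳ 0#)
  sumF-+ {suc m} f g = begin
    (f zero + g zero) + sumF (λ i → f (suc i) + g (suc i))
      ≈⟨ +-congˡ (sumF-+ (λ i → f (suc i)) (λ i → g (suc i))) ⟩
    (f zero + g zero) + (sumF (λ i → f (suc i)) + sumF (λ i → g (suc i)))
      ≈⟨ solve 4 (λ a b c d → (a :+ b) :+ (c :+ d) := (a :+ c) :+ (b :+ d)) refl _ _ _ _ ⟩
    (f zero + sumF (λ i → f (suc i))) + (g zero + sumF (λ i → g (suc i))) ∎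

  sumF-distribˡ : ∀ {m} a (f : Fin m → Carrier) → a * sumF f ≈ sumF (λ i → a * f i)
  sumF-distribˡ {zero}  a f = zeroʳ a
  sumF-distribˡ {suc m} a f = trans (distribˡ a _ _) (+-congˡ (sumF-distribˡ a (λ i → f (suc i))))

  sumF-distribʳ : ∀ {m} a (f : Fin m → Carrier) → sumF f * a ≈ sumF (λ i → f i * a)
  sumF-distribʳ a f = trans (*-comm _ a) (trans (sumF-distribˡ a f) (sumF-cong (λ i → *-comm a (f i))))

  sumF-zero : ∀ {m} (f : Fin m → Carrier) → (∀ i → f i ≈ 0#) → sumF f ≈ 0#
  sumF-zero {zero}  f e = refl
  sumF-zero {suc m} f e = trans (+-cong (e zero) (sumF-zero (λ i → f (suc i)) (λ i → e (suc i)))) (+-identityˡ 0#)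

  sumF-neg : ∀ {m} (f : Fin m → Carrier) → - sumF f ≈ sumF (λ i → - f i)
  sumF-neg {zero}  f = solve 0 (:- con (+ 0) := con (+ 0)) refl
  sumF-neg {suc m} f = trans (solve 2 (λ a b → :- (a :+ b) := (:- a) :+ (:- b)) refl (f zero) _)
                             (+-congˡ (sumF-neg (λ i → f (suc i))))

  sumF-comm : ∀ {m k} (f : Fin m → Fin k → Carrier) →
              sumF (λ i → sumF (λ j → f i j)) ≈ sumF (λ j → sumF (λ i → f i j))
  sumF-comm {zero}  {k} f = sym (sumF-zero {k} (λ j → 0#) (λ _ → refl))
  sumF-comm {suc m} {k} f = begin
    sumF (f zero) + sumF (λ i → sumF (λ j → f (suc i) j)) ≈⟨ +-congˡ (sumF-comm (λ i j → f (suc i) j)) ⟩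
    sumF (f zero) + sumF (λ j → sumF (λ i → f (suc i) j)) ≈⟨ sumF-+ (f zero) _ ⟨
    sumF (λ j → f zero j + sumF (λ i → f (suc i) j))      ∎

  δ : ℕ → ℕ → Carrier
  δ zero    zero    = 1#
  δ zero    (suc b) = 0#
  δ (suc a) zero    = 0#
  δ (suc a) (suc b) = δ a b

  δ-refl : ∀ a → δ a a ≈ 1#
  δ-refl zero    = refl
  δ-refl (suc a) = δ-refl a

  δ-≢ : ∀ a b → ¬ a ≡ b → δ a b ≈ 0#
  δ-≢ zero    zero    a≢b = ⊥-elim (a≢b P.refl)
  δ-≢ zero    (suc b) a≢b = refl
  δ-≢ (suc a) zero    a≢b = refl
  δ-≢ (suc a) (suc b) a≢b = δ-≢ a b (λ e → a≢b (P.cong suc e))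

  sumF-δ : ∀ {m} (F : ℕ → Carrier) t → t ℕ.< m → sumF {m} (λ k → δ (toℕ k) t * F (toℕ k)) ≈ F t
  sumF-δ {suc m} F zero _ = begin
    1# * F 0 + sumF {m} (λ k → 0# * F (suc (toℕ k))) ≈⟨ +-cong (*-identityˡ _) (sumF-zero {m} _ (λ k → zeroˡ _)) ⟩
    F 0 + 0#                                           ≈⟨ +-identityʳ _ ⟩
    F 0                                                ∎
  sumF-δ {suc m} F (suc t) (s≤s t<m) = begin
    0# * F 0 + sumF {m} (λ k → δ (toℕ k) t * F (suc (toℕ k))) ≈⟨ +-cong (zeroˡ _) (sumF-δ (λ k → F (suc k)) t t<m) ⟩
    0# + F (suc t)                                              ≈⟨ +-identityˡ _ ⟩
    F (suc t)                                                   ∎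

  sumF-δ-≥ : ∀ {m} (F : ℕ → Carrier) t → m ℕ.≤ t → sumF {m} (λ k → δ (toℕ k) t * F (toℕ k)) ≈ 0#
  sumF-δ-≥ {zero}  F t       _         = refl
  sumF-δ-≥ {suc m} F (suc t) (s≤s m≤t) = begin
    0# * F 0 + sumF {m} (λ k → δ (toℕ k) t * F (suc (toℕ k))) ≈⟨ +-cong (zeroˡ _) (sumF-δ-≥ (λ k → F (suc k)) t m≤t) ⟩
    0# + 0#                                                     ≈⟨ +-identityˡ _ ⟩
    0#                                                          ∎

  sumF-δᶠ : ∀ {m} (i : Fin m) (f : Fin m → Carrier) → sumF (λ a → δ (toℕ i) (toℕ a) * f a) ≈ f i
  sumF-δᶠ {suc m} zero f = begin
    1# * f zero + sumF {m} (λ a → 0# * f (suc a)) ≈⟨ +-cong (*-identityˡ _) (sumF-zero {m} _ (λ k → zeroˡ _)) ⟩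
    f zero + 0#                                    ≈⟨ +-identityʳ _ ⟩
    f zero                                         ∎
  sumF-δᶠ {suc m} (suc i) f = begin
    0# * f zero + sumF {m} (λ a → δ (toℕ i) (toℕ a) * f (suc a)) ≈⟨ +-cong (zeroˡ _) (sumF-δᶠ i (λ a → f (suc a))) ⟩
    0# + f (suc i)                                                ≈⟨ +-identityˡ _ ⟩
    f (suc i)                                                     ∎

  alt-cong : ∀ k {a b} → a ≈ b → alt k a ≈ alt k b
  alt-cong zero    e = e
  alt-cong (suc k) e = -‿cong (alt-cong k e)

  alt-*ˡ : ∀ k a b → alt k (a * b) ≈ a * alt k b
  alt-*ˡ zero    a b = refl
  alt-*ˡ (suc k) a b = trans (-‿cong (alt-*ˡ k a b)) (-‿distribʳ-* a (alt k b))

  alt-+ : ∀ k a b → alt k (a + b) ≈ alt k a + alt k b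
  alt-+ zero    a b = refl
  alt-+ (suc k) a b = trans (-‿cong (alt-+ k a b)) (solve 2 (λ a c → :- (a :+ c) := (:- a) :+ (:- c)) refl (alt k a) (alt k b))

  alt-neg : ∀ k a → alt k (- a) ≈ - alt k a
  alt-neg zero    a = refl
  alt-neg (suc k) a = -‿cong (alt-neg k a)

  alt-zero : ∀ k → alt k 0# ≈ 0#
  alt-zero zero    = refl
  alt-zero (suc k) = trans (-‿cong (alt-zero k)) (solve 0 (:- con (+ 0) := con (+ 0)) refl)

  alt-comm : ∀ k l a → alt k (alt l a) ≈ alt l (alt k a)
  alt-comm zero    l a = refl
  alt-comm (suc k) l a = trans (-‿cong (alt-comm k l a)) (sym (alt-neg l (alt k a)))

  alt-sumF : ∀ {m} k (f : Fin m → Carrier) → alt k (sumF f) ≈ sumF (λ i → alt k (f i))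
  alt-sumF {zero}  k f = alt-zero k
  alt-sumF {suc m} k f = trans (alt-+ k _ _) (+-congˡ (alt-sumF k (λ i → f (suc i))))

  -- Determinants

  Mat : ℕ → Set c
  Mat m = Fin m → Fin m → Carrier

  minor : ∀ {m} → Fin (suc m) → Mat (suc m) → Mat m
  minor j M r s = M (suc r) (punchIn j s)

  expansionTerm : ∀ {m} → Mat (suc m) → Fin (suc m) → Carrier
  expansionTerm M j = alt (toℕ j) (M zero j * det (minor j M))

  reindex : ∀ {m} (X Y : Mat m) i {u u′ v v′} → u ≡ u′ → v ≡ v′ → X i u′ ≈ Y i v′ → X i u ≈ Y i v
  reindex X Y i P.refl P.refl e = e

  det-cong : ∀ {m} {M N : Mat m} → (∀ i j → M i j ≈ N i j) → det M ≈ det N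
  det-cong {zero}  e = refl
  det-cong {suc m} e = sumF-cong (λ j → alt-cong (toℕ j) (*-cong (e zero j) (det-cong (λ r s → e (suc r) (punchIn j s)))))

  det-linearInColumn : ∀ {m p} (X : Mat m) (Y : Fin p → Mat m) (coef : Fin p → Carrier) (col : Fin m) →
                       (∀ a i j → ¬ j ≡ col → Y a i j ≈ X i j) →
                       (∀ i → X i col ≈ sumF (λ a → coef a * Y a i col)) →
                       det X ≈ sumF (λ a → coef a * det (Y a))
  det-linearInColumn {suc m} {p} X Y coef col Y≈X X≈ΣY = begin
    sumF (expansionTerm X)                                       ≈⟨ sumF-cong termLinear ⟩
    sumF (λ j → sumF (λ a → coef a * expansionTerm (Y a) j))     ≈⟨ sumF-comm (λ j a → coef a * expansionTerm (Y a) j) ⟩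
    sumF (λ a → sumF (λ j → coef a * expansionTerm (Y a) j))     ≈⟨ sumF-cong (λ a → sumF-distribˡ (coef a) (expansionTerm (Y a))) ⟨
    sumF (λ a → coef a * det (Y a))                              ∎
    where
    termLinear : ∀ j → expansionTerm X j ≈ sumF (λ a → coef a * expansionTerm (Y a) j)
    termLinear j with j Fin.≟ col
    ... | yes P.refl = begin
      alt (toℕ j) (X zero j * det (minor j X))                          ≈⟨ alt-cong (toℕ j) (*-congʳ (X≈ΣY zero)) ⟩
      alt (toℕ j) (sumF (λ a → coef a * Y a zero j) * det (minor j X))  ≈⟨ alt-cong (toℕ j) (sumF-distribʳ {p} _ _) ⟩
      alt (toℕ j) (sumF (λ a → coef a * Y a zero j * det (minor j X)))  ≈⟨ alt-sumF {p} (toℕ j) _ ⟩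
      sumF (λ a → alt (toℕ j) (coef a * Y a zero j * det (minor j X)))
        ≈⟨ sumF-cong (λ a → trans (alt-cong (toℕ j) (trans (*-assoc _ _ _) (*-congˡ (*-congˡ
             (det-cong (λ r s → sym (Y≈X a (suc r) (punchIn j s) (punchInᵢ≢i j s)))))))) (alt-*ˡ (toℕ j) _ _)) ⟩
      sumF (λ a → coef a * expansionTerm (Y a) j)                       ∎
    ... | no j≢col = begin
      alt (toℕ j) (X zero j * det (minor j X))                              ≈⟨ alt-cong (toℕ j) (*-congˡ minorLinear) ⟩
      alt (toℕ j) (X zero j * sumF (λ a → coef a * det (minor j (Y a))))    ≈⟨ alt-cong (toℕ j) (sumF-distribˡ {p} _ _) ⟩
      alt (toℕ j) (sumF (λ a → X zero j * (coef a * det (minor j (Y a)))))  ≈⟨ alt-sumF {p} (toℕ j) _ ⟩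
      sumF (λ a → alt (toℕ j) (X zero j * (coef a * det (minor j (Y a)))))
        ≈⟨ sumF-cong (λ a → trans (alt-cong (toℕ j) (trans (solve 3 (λ x c d → x :* (c :* d) := c :* (x :* d)) refl _ _ _)
             (*-congˡ (*-congʳ (sym (Y≈X a zero j j≢col)))))) (alt-*ˡ (toℕ j) _ _)) ⟩
      sumF (λ a → coef a * expansionTerm (Y a) j)                           ∎
      where
      col′ = punchOut j≢col
      punchIn-col′ : punchIn j col′ ≡ col
      punchIn-col′ = punchIn-punchOut j≢col
      minorLinear : det (minor j X) ≈ sumF (λ a → coef a * det (minor j (Y a)))
      minorLinear = det-linearInColumn (minor j X) (λ a → minor j (Y a)) coef col′
        (λ a r s s≢col′ → Y≈X a (suc r) (punchIn j s)
                            (λ e → s≢col′ (punchIn-injective j s col′ (P.trans e (P.sym punchIn-col′)))))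
        (λ r → P.subst (λ q → X (suc r) q ≈ sumF (λ a → coef a * Y a (suc r) q)) (P.sym punchIn-col′) (X≈ΣY (suc r)))

  det-zeroColumn : ∀ {m} (X : Mat m) (col : Fin m) → (∀ i → X i col ≈ 0#) → det X ≈ 0#
  det-zeroColumn X col X≈0 = det-linearInColumn {p = 0} X (λ ()) (λ ()) col (λ ()) X≈0

  det-lowerUnitriangular : ∀ {m} (M : Mat m) → (∀ i → M i i ≈ 1#) →
                           (∀ i j → toℕ i ℕ.< toℕ j → M i j ≈ 0#) → det M ≈ 1#
  det-lowerUnitriangular {zero}  M diag upper = refl
  det-lowerUnitriangular {suc m} M diag upper = begin
    expansionTerm M zero + sumF (λ k → expansionTerm M (suc k)) ≈⟨ +-cong firstTerm (sumF-zero {m} _ otherTerms) ⟩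
    1# + 0#                                                     ≈⟨ +-identityʳ _ ⟩
    1#                                                          ∎
    where
    firstTerm : expansionTerm M zero ≈ 1#
    firstTerm = trans (*-cong (diag zero) (det-lowerUnitriangular (minor zero M) (λ i → diag (suc i))
                                             (λ i j i<j → upper (suc i) (suc j) (s≤s i<j))))
                      (*-identityˡ 1#)
    otherTerms : ∀ k → expansionTerm M (suc k) ≈ 0#
    otherTerms k = trans (alt-cong (toℕ (suc k)) (trans (*-congʳ (upper zero (suc k) (s≤s z≤n))) (zeroˡ _)))
                         (alt-zero (toℕ (suc k)))

  data Adjacent : ∀ {k} → Fin (suc (suc k)) → Fin (suc (suc k)) → Set where
    adjacent-0   : ∀ {k} → Adjacent {k} zero (suc zero)
    adjacent-suc : ∀ {k} {d e : Fin (suc (suc k))} → Adjacent {k} d e → Adjacent {suc k} (suc d) (suc e)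

  adjacent-toℕ : ∀ {k} {d e : Fin (suc (suc k))} → Adjacent d e → toℕ e ≡ suc (toℕ d)
  adjacent-toℕ adjacent-0       = P.refl
  adjacent-toℕ (adjacent-suc a) = P.cong suc (adjacent-toℕ a)

  adjacent-punchIn : ∀ {k} {d e : Fin (suc (suc k))} → Adjacent d e → ∀ s →
                     punchIn d s ≡ punchIn e s ⊎ (punchIn d s ≡ e × punchIn e s ≡ d)
  adjacent-punchIn adjacent-0       zero    = inj₂ (P.refl , P.refl)
  adjacent-punchIn adjacent-0       (suc s) = inj₁ P.refl
  adjacent-punchIn (adjacent-suc a) zero    = inj₁ P.refl
  adjacent-punchIn (adjacent-suc a) (suc s) with adjacent-punchIn a s
  ... | inj₁ e          = inj₁ (P.cong suc e)
  ... | inj₂ (e₁ , e₂) = inj₂ (P.cong suc e₁ , P.cong suc e₂)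

  adjacent-minor : ∀ {k} {d e : Fin (suc (suc (suc k)))} → Adjacent {suc k} d e → (j : Fin (suc (suc (suc k)))) →
                   ¬ j ≡ d → ¬ j ≡ e →
                   Σ (Fin (suc (suc k))) λ d′ → Σ (Fin (suc (suc k))) λ e′ →
                     Adjacent {k} d′ e′ × punchIn j d′ ≡ d × punchIn j e′ ≡ e
  adjacent-minor adjacent-0 zero          j≢d j≢e = ⊥-elim (j≢d P.refl)
  adjacent-minor adjacent-0 (suc zero)    j≢d j≢e = ⊥-elim (j≢e P.refl)
  adjacent-minor adjacent-0 (suc (suc j)) j≢d j≢e = zero , suc zero , adjacent-0 , P.refl , P.refl
  adjacent-minor (adjacent-suc a) zero j≢d j≢e = _ , _ , a , P.refl , P.refl
  adjacent-minor {suc k} (adjacent-suc a) (suc j) j≢d j≢e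
    with adjacent-minor a j (λ e → j≢d (P.cong suc e)) (λ e → j≢e (P.cong suc e))
  ... | d′ , e′ , a′ , p , q = suc d′ , suc e′ , adjacent-suc a′ , P.cong suc p , P.cong suc q
  adjacent-minor {zero} (adjacent-suc adjacent-0) (suc zero)       j≢d j≢e = ⊥-elim (j≢d P.refl)
  adjacent-minor {zero} (adjacent-suc adjacent-0) (suc (suc zero)) j≢d j≢e = ⊥-elim (j≢e P.refl)

  outside : ∀ {k} {d e : Fin (suc (suc k))} → Adjacent d e → Fin k → Fin (suc (suc k))
  outside adjacent-0       i       = suc (suc i)
  outside (adjacent-suc a) zero    = zero
  outside (adjacent-suc a) (suc i) = suc (outside a i)

  outside≢d : ∀ {k} {d e : Fin (suc (suc k))} (a : Adjacent d e) i → ¬ outside a i ≡ d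
  outside≢d adjacent-0       i       ()
  outside≢d (adjacent-suc a) zero    ()
  outside≢d (adjacent-suc a) (suc i) e = outside≢d a i (suc-injective e)

  outside≢e : ∀ {k} {d e : Fin (suc (suc k))} (a : Adjacent d e) i → ¬ outside a i ≡ e
  outside≢e adjacent-0       i       ()
  outside≢e (adjacent-suc a) zero    ()
  outside≢e (adjacent-suc a) (suc i) e = outside≢e a i (suc-injective e)

  sumF-adjacent : ∀ {k} {d e : Fin (suc (suc k))} (a : Adjacent d e) (f : Fin (suc (suc k)) → Carrier) →
                  sumF f ≈ f d + (f e + sumF (λ i → f (outside a i)))
  sumF-adjacent adjacent-0 f = refl
  sumF-adjacent {suc k} (adjacent-suc {d = d} {e} a) f = begin
    f zero + sumF (λ i → f (suc i))
      ≈⟨ +-congˡ (sumF-adjacent a (λ i → f (suc i))) ⟩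
    f zero + (f (suc d) + (f (suc e) + sumF (λ i → f (suc (outside a i)))))
      ≈⟨ solve 4 (λ w x y z → w :+ (x :+ (y :+ z)) := x :+ (y :+ (w :+ z))) refl _ _ _ _ ⟩
    f (suc d) + (f (suc e) + (f zero + sumF (λ i → f (suc (outside a i))))) ∎

  det-equalAdjacentColumns : ∀ {k} {d e : Fin (suc (suc k))} → Adjacent d e → (X : Mat (suc (suc k))) →
                             (∀ i → X i d ≈ X i e) → det X ≈ 0#
  det-equalAdjacentColumns {k} {d} {e} a X d≈e = begin
    sumF (expansionTerm X)
      ≈⟨ sumF-adjacent a (expansionTerm X) ⟩
    expansionTerm X d + (expansionTerm X e + sumF (λ i → expansionTerm X (outside a i)))
      ≈⟨ +-assoc _ _ _ ⟨
    (expansionTerm X d + expansionTerm X e) + sumF (λ i → expansionTerm X (outside a i))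
      ≈⟨ +-cong pairCancels (sumF-zero _ (outsideVanishes k a X d≈e)) ⟩
    0# + 0#
      ≈⟨ +-identityʳ 0# ⟩
    0# ∎
    where
    sameMinor : ∀ r s → minor e X r s ≈ minor d X r s
    sameMinor r s with adjacent-punchIn a s
    ... | inj₁ q        = ≡⇒≈ (P.cong (X (suc r)) (P.sym q))
    ... | inj₂ (q , q′) = reindex X X (suc r) q′ q (d≈e (suc r))
    pairCancels : expansionTerm X d + expansionTerm X e ≈ 0#
    pairCancels = begin
      alt (toℕ d) (X zero d * det (minor d X)) + alt (toℕ e) (X zero e * det (minor e X))
        ≈⟨ +-congˡ (≡⇒≈ (P.cong (λ t → alt t (X zero e * det (minor e X))) (adjacent-toℕ a))) ⟩
      alt (toℕ d) (X zero d * det (minor d X)) + - alt (toℕ d) (X zero e * det (minor e X))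
        ≈⟨ +-congˡ (-‿cong (alt-cong (toℕ d) (*-cong (sym (d≈e zero)) (det-cong sameMinor)))) ⟩
      alt (toℕ d) (X zero d * det (minor d X)) + - alt (toℕ d) (X zero d * det (minor d X))
        ≈⟨ -‿inverseʳ _ ⟩
      0# ∎
    outsideVanishes : ∀ k {d e : Fin (suc (suc k))} (a : Adjacent {k} d e) (X : Mat (suc (suc k))) →
                      (∀ i → X i d ≈ X i e) → ∀ i → expansionTerm X (outside a i) ≈ 0#
    outsideVanishes (suc k) a X d≈e i with adjacent-minor a (outside a i) (outside≢d a i) (outside≢e a i)
    ... | d′ , e′ , a′ , p , q =
      trans (alt-cong (toℕ (outside a i))
              (trans (*-congˡ (det-equalAdjacentColumns a′ (minor (outside a i) X)
                                 (λ r → reindex X X (suc r) p q (d≈e (suc r)))))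
                     (zeroʳ _)))
            (alt-zero (toℕ (outside a i)))

  det-swapAdjacentColumns : ∀ {k} {d e : Fin (suc (suc k))} → Adjacent d e → (X Y : Mat (suc (suc k))) →
                            (∀ i → Y i d ≈ X i e) → (∀ i → Y i e ≈ X i d) →
                            (∀ i j → ¬ j ≡ d → ¬ j ≡ e → Y i j ≈ X i j) → det Y ≈ - det X
  det-swapAdjacentColumns {k} {d} {e} a X Y Yd≈Xe Ye≈Xd Y≈X = begin
    sumF (expansionTerm Y)
      ≈⟨ sumF-adjacent a (expansionTerm Y) ⟩
    expansionTerm Y d + (expansionTerm Y e + sumF (λ i → expansionTerm Y (outside a i)))
      ≈⟨ +-cong termAt-d (+-cong termAt-e (sumF-cong (outsideNegated k a X Y Yd≈Xe Ye≈Xd Y≈X))) ⟩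
    - expansionTerm X e + (- expansionTerm X d + sumF (λ i → - expansionTerm X (outside a i)))
      ≈⟨ +-congˡ (+-congˡ (sumF-neg {k} (λ i → expansionTerm X (outside a i)))) ⟨
    - expansionTerm X e + (- expansionTerm X d + - sumF (λ i → expansionTerm X (outside a i)))
      ≈⟨ solve 3 (λ x y z → (:- y) :+ ((:- x) :+ (:- z)) := :- (x :+ (y :+ z))) refl _ _ _ ⟩
    - (expansionTerm X d + (expansionTerm X e + sumF (λ i → expansionTerm X (outside a i))))
      ≈⟨ -‿cong (sumF-adjacent a (expansionTerm X)) ⟨
    - sumF (expansionTerm X) ∎
    where
    alt-e : ∀ t → alt (toℕ e) t ≈ - alt (toℕ d) t
    alt-e t = ≡⇒≈ (P.cong (λ u → alt u t) (adjacent-toℕ a))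
    minor-d : ∀ r s → minor d Y r s ≈ minor e X r s
    minor-d r s with adjacent-punchIn a s
    ... | inj₁ q = P.subst (λ u → Y (suc r) (punchIn d s) ≈ X (suc r) u) q
                     (Y≈X (suc r) (punchIn d s) (punchInᵢ≢i d s) (λ x → punchInᵢ≢i e s (P.trans (P.sym q) x)))
    ... | inj₂ (q , q′) = reindex Y X (suc r) q q′ (Ye≈Xd (suc r))
    minor-e : ∀ r s → minor e Y r s ≈ minor d X r s
    minor-e r s with adjacent-punchIn a s
    ... | inj₁ q = P.subst (λ u → Y (suc r) (punchIn e s) ≈ X (suc r) u) (P.sym q)
                     (Y≈X (suc r) (punchIn e s) (λ x → punchInᵢ≢i d s (P.trans q x)) (punchInᵢ≢i e s))
    ... | inj₂ (q , q′) = reindex Y X (suc r) q′ q (Yd≈Xe (suc r))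
    termAt-d : expansionTerm Y d ≈ - expansionTerm X e
    termAt-d = begin
      alt (toℕ d) (Y zero d * det (minor d Y))      ≈⟨ alt-cong (toℕ d) (*-cong (Yd≈Xe zero) (det-cong minor-d)) ⟩
      alt (toℕ d) (X zero e * det (minor e X))      ≈⟨ solve 1 (λ a → :- (:- a) := a) refl _ ⟨
      - - alt (toℕ d) (X zero e * det (minor e X))  ≈⟨ -‿cong (alt-e _) ⟨
      - expansionTerm X e                           ∎
    termAt-e : expansionTerm Y e ≈ - expansionTerm X d
    termAt-e = begin
      alt (toℕ e) (Y zero e * det (minor e Y))      ≈⟨ alt-e _ ⟩
      - alt (toℕ d) (Y zero e * det (minor e Y))    ≈⟨ -‿cong (alt-cong (toℕ d) (*-cong (Ye≈Xd zero) (det-cong minor-e))) ⟩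
      - expansionTerm X d                           ∎
    outsideNegated : ∀ k {d e : Fin (suc (suc k))} (a : Adjacent {k} d e) (X Y : Mat (suc (suc k))) →
                     (∀ i → Y i d ≈ X i e) → (∀ i → Y i e ≈ X i d) → (∀ i j → ¬ j ≡ d → ¬ j ≡ e → Y i j ≈ X i j) →
                     ∀ i → expansionTerm Y (outside a i) ≈ - expansionTerm X (outside a i)
    outsideNegated (suc k) a X Y Yd≈Xe Ye≈Xd Y≈X i with adjacent-minor a (outside a i) (outside≢d a i) (outside≢e a i)
    ... | d′ , e′ , a′ , p , q = begin
      alt t (Y zero j * det (minor j Y))      ≈⟨ alt-cong t (*-cong (Y≈X zero j (outside≢d a i) (outside≢e a i)) minorSwapped) ⟩
      alt t (X zero j * - det (minor j X))    ≈⟨ alt-cong t (-‿distribʳ-* _ _) ⟨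
      alt t (- (X zero j * det (minor j X)))  ≈⟨ alt-neg t _ ⟩
      - expansionTerm X j                     ∎
      where
      j = outside a i
      t = toℕ j
      minorSwapped : det (minor j Y) ≈ - det (minor j X)
      minorSwapped = det-swapAdjacentColumns a′ (minor j X) (minor j Y)
        (λ r → reindex Y X (suc r) p q (Yd≈Xe (suc r)))
        (λ r → reindex Y X (suc r) q p (Ye≈Xd (suc r)))
        (λ r s s≢d′ s≢e′ → Y≈X (suc r) (punchIn j s)
           (λ x → s≢d′ (punchIn-injective j s d′ (P.trans x (P.sym p))))
           (λ x → s≢e′ (punchIn-injective j s e′ (P.trans x (P.sym q)))))

  permuteColumns : ∀ {m} → Mat m → (Fin m → Fin m) → Mat m
  permuteColumns M σ i j = M i (σ j)

  𝟙 : ∀ {m} → Mat m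
  𝟙 i j = δ (toℕ i) (toℕ j)

  det-𝟙 : ∀ {m} → det (𝟙 {m}) ≈ 1#
  det-𝟙 {m} = det-lowerUnitriangular {m} 𝟙 (λ i → δ-refl (toℕ i)) (λ i j i<j → δ-≢ (toℕ i) (toℕ j) (ℕₚ.<⇒≢ i<j))

  Descent : ∀ {k} → (Fin (suc (suc k)) → ℕ) → Set
  Descent {k} g = Σ (Fin (suc (suc k))) λ d → Σ (Fin (suc (suc k))) λ e → Adjacent {k} d e × g e ℕ.≤ g d

  descent⊎increasing : ∀ {k} (g : Fin (suc (suc k)) → ℕ) →
                       Descent g ⊎ (∀ {d e} → Adjacent {k} d e → g d ℕ.< g e)
  descent⊎increasing {k} g with g (suc zero) ℕ.≤? g zero
  ... | yes g₁≤g₀ = inj₁ (zero , suc zero , adjacent-0 , g₁≤g₀)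
  descent⊎increasing {zero} g | no g₁≰g₀ = inj₂ λ { adjacent-0 → ℕₚ.≰⇒> g₁≰g₀ }
  descent⊎increasing {suc k} g | no g₁≰g₀ with descent⊎increasing (λ j → g (suc j))
  ... | inj₁ (d , e , a , ge≤gd) = inj₁ (suc d , suc e , adjacent-suc a , ge≤gd)
  ... | inj₂ increasing         = inj₂ λ { adjacent-0 → ℕₚ.≰⇒> g₁≰g₀ ; (adjacent-suc a) → increasing a }

  adjacent-inject₁ : ∀ {k} (j : Fin (suc k)) → Adjacent {k} (inject₁ j) (suc j)
  adjacent-inject₁ {k}     zero    = adjacent-0
  adjacent-inject₁ {suc k} (suc j) = adjacent-suc (adjacent-inject₁ j)

  increasing⇒toℕ : ∀ m (g : Fin (suc m) → ℕ) → (∀ j → g (inject₁ j) ℕ.< g (suc j)) →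
                   (∀ j → g j ℕ.< suc m) → ∀ j → g j ≡ toℕ j
  increasing⇒toℕ zero g _ bounded zero with g zero | bounded zero
  ... | zero  | _       = P.refl
  ... | suc _ | s≤s ()
  increasing⇒toℕ (suc m) g increasing bounded = g≡toℕ
    where
    -- g ∘ suc is positive, so g′ = pred ∘ g ∘ suc is again increasing and bounded.
    g′ : Fin (suc m) → ℕ
    g′ j = ℕ.pred (g (suc j))
    suc-g′ : ∀ j → suc (g′ j) ≡ g (suc j)
    suc-g′ j with g (suc j) | ℕₚ.≤-<-trans z≤n (increasing j)
    ... | suc _ | _ = P.refl
    g′≡toℕ : ∀ j → g′ j ≡ toℕ j
    g′≡toℕ = increasing⇒toℕ m g′
      (λ j → ℕₚ.<⇒≤pred (P.subst (ℕ._< g (suc (suc j))) (P.sym (suc-g′ (inject₁ j))) (increasing (suc j))))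
      (λ j → ℕ.s≤s⁻¹ (P.subst (ℕ._< suc (suc m)) (P.sym (suc-g′ j)) (bounded (suc j))))
    g≡toℕ : ∀ j → g j ≡ toℕ j
    g≡toℕ (suc j) = P.trans (P.sym (suc-g′ j)) (P.cong suc (g′≡toℕ j))
    g≡toℕ zero with g zero | ℕₚ.<-≤-trans (increasing zero) (ℕₚ.≤-reflexive (P.trans (P.sym (suc-g′ zero)) (P.cong suc (g′≡toℕ zero))))
    ... | zero  | _             = P.refl
    ... | suc _ | s≤s ()

  swap : ∀ {k} {d e : Fin (suc (suc k))} → Adjacent d e → Fin (suc (suc k)) → Fin (suc (suc k))
  swap adjacent-0       zero          = suc zero
  swap adjacent-0       (suc zero)    = zero
  swap adjacent-0       (suc (suc i)) = suc (suc i)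
  swap (adjacent-suc a) zero          = zero
  swap (adjacent-suc a) (suc i)       = suc (swap a i)

  swap-d : ∀ {k} {d e : Fin (suc (suc k))} (a : Adjacent d e) → swap a d ≡ e
  swap-d adjacent-0       = P.refl
  swap-d (adjacent-suc a) = P.cong suc (swap-d a)

  swap-e : ∀ {k} {d e : Fin (suc (suc k))} (a : Adjacent d e) → swap a e ≡ d
  swap-e adjacent-0       = P.refl
  swap-e (adjacent-suc a) = P.cong suc (swap-e a)

  swap-outside : ∀ {k} {d e : Fin (suc (suc k))} (a : Adjacent d e) j → ¬ j ≡ d → ¬ j ≡ e → swap a j ≡ j
  swap-outside adjacent-0       zero          j≢d j≢e = ⊥-elim (j≢d P.refl)
  swap-outside adjacent-0       (suc zero)    j≢d j≢e = ⊥-elim (j≢e P.refl)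
  swap-outside adjacent-0       (suc (suc j)) j≢d j≢e = P.refl
  swap-outside (adjacent-suc a) zero          j≢d j≢e = P.refl
  swap-outside (adjacent-suc a) (suc j)       j≢d j≢e =
    P.cong suc (swap-outside a j (λ x → j≢d (P.cong suc x)) (λ x → j≢e (P.cong suc x)))

  sumℕ : ∀ {m} → (Fin m → ℕ) → ℕ
  sumℕ {zero}  f = 0
  sumℕ {suc m} f = f zero ℕ.+ sumℕ (λ i → f (suc i))

  sumℕ-cong : ∀ {m} {f g : Fin m → ℕ} → (∀ i → f i ≡ g i) → sumℕ f ≡ sumℕ g
  sumℕ-cong {zero}  e = P.refl
  sumℕ-cong {suc m} e = P.cong₂ ℕ._+_ (e zero) (sumℕ-cong (λ i → e (suc i)))

  sumℕ-adjacent : ∀ {k} {d e : Fin (suc (suc k))} (a : Adjacent d e) (f : Fin (suc (suc k)) → ℕ) →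
                  sumℕ f ≡ f d ℕ.+ (f e ℕ.+ sumℕ (λ i → f (outside a i)))
  sumℕ-adjacent adjacent-0 f = P.refl
  sumℕ-adjacent {suc k} (adjacent-suc {d = d} {e} a) f =
    P.trans (P.cong (f zero ℕ.+_) (sumℕ-adjacent a (λ i → f (suc i)))) (IndexArithmetic.rotate (f zero) (f (suc d)) (f (suc e)) _)

  sumℕ-bound : ∀ {m} (f : Fin m → ℕ) b → (∀ i → f i ℕ.≤ b) → sumℕ f ℕ.≤ m ℕ.* b
  sumℕ-bound {zero}  f b f≤b = z≤n
  sumℕ-bound {suc m} f b f≤b = ℕₚ.+-mono-≤ (f≤b zero) (sumℕ-bound (λ i → f (suc i)) b (λ i → f≤b (suc i)))

  -- The termination measure for bubble-sorting σ in permutationSign-acc.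
  sortedness : ∀ {m} → (Fin m → Fin m) → ℕ
  sortedness σ = sumℕ (λ j → toℕ j ℕ.* toℕ (σ j))

  sortedness-bound : ∀ {m} (σ : Fin m → Fin m) → sortedness σ ℕ.≤ m ℕ.* (m ℕ.* m)
  sortedness-bound {m} σ =
    sumℕ-bound _ (m ℕ.* m) (λ j → ℕₚ.*-mono-≤ (ℕₚ.<⇒≤ (toℕ<n j)) (ℕₚ.<⇒≤ (toℕ<n (σ j))))

  rearrangement : ∀ D A B S → B ℕ.< A → D ℕ.* A ℕ.+ (suc D ℕ.* B ℕ.+ S) ℕ.< D ℕ.* B ℕ.+ (suc D ℕ.* A ℕ.+ S)
  rearrangement D A B S B<A =
    P.subst (λ A → before A ℕ.< after A) (ℕₚ.m+[n∸m]≡n B<A)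
      (P.subst (before (suc B ℕ.+ t) ℕ.<_) (IndexArithmetic.rearrangementGain D B t S) (ℕₚ.m<m+n (before (suc B ℕ.+ t)) (s≤s z≤n)))
    where
    t = A ℕ.∸ suc B
    before after : ℕ → ℕ
    before A = D ℕ.* A ℕ.+ (suc D ℕ.* B ℕ.+ S)
    after  A = D ℕ.* B ℕ.+ (suc D ℕ.* A ℕ.+ S)

  sortedness-swap : ∀ {k} {d e : Fin (suc (suc k))} (a : Adjacent d e) (σ : Fin (suc (suc k)) → Fin (suc (suc k))) →
                    toℕ (σ e) ℕ.< toℕ (σ d) → sortedness σ ℕ.< sortedness (λ j → σ (swap a j))
  sortedness-swap {d = d} {e} a σ σe<σd
    rewrite sumℕ-adjacent a (λ j → toℕ j ℕ.* toℕ (σ j))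
          | sumℕ-adjacent a (λ j → toℕ j ℕ.* toℕ (σ (swap a j)))
          | adjacent-toℕ a | swap-d a | swap-e a
          | sumℕ-cong (λ i → P.cong (λ j → toℕ (outside a i) ℕ.* toℕ (σ j))
                                    (swap-outside a (outside a i) (outside≢d a i) (outside≢e a i)))
    = rearrangement (toℕ d) (toℕ (σ d)) (toℕ (σ e)) _ σe<σd

  PermutationSign : ∀ {m} → (Fin m → Fin m) → Set (c ⊔ ℓ)
  PermutationSign σ = ∀ M → det (permuteColumns M σ) ≈ det (permuteColumns 𝟙 σ) * det M

  permutationSign-id : ∀ {m} (σ : Fin m → Fin m) → (∀ j → σ j ≡ j) → PermutationSign σ
  permutationSign-id {m} σ σ≡id M = begin
    det (permuteColumns M σ)      ≈⟨ det-cong (λ i j → ≡⇒≈ (P.cong (M i) (σ≡id j))) ⟩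
    det M                         ≈⟨ *-identityˡ _ ⟨
    1# * det M                    ≈⟨ *-congʳ (trans (det-cong (λ i j → ≡⇒≈ (P.cong (𝟙 i) (σ≡id j)))) (det-𝟙 {m})) ⟨
    det (permuteColumns 𝟙 σ) * det M ∎

  permutationSign-acc : ∀ {k} (σ : Fin (suc (suc k)) → Fin (suc (suc k))) →
                        Acc ℕ._<_ (suc (suc k) ℕ.* (suc (suc k) ℕ.* suc (suc k)) ℕ.∸ sortedness σ) →
                        PermutationSign σ
  permutationSign-acc {k} σ (acc smaller) with descent⊎increasing (λ j → toℕ (σ j))
  ... | inj₂ increasing =
    permutationSign-id σ (λ j → toℕ-injective (increasing⇒toℕ (suc k) (λ j → toℕ (σ j))
                                  (λ j → increasing (adjacent-inject₁ j)) (λ j → toℕ<n (σ j)) j))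
  ... | inj₁ (d , e , a , σe≤σd) with ℕₚ.m≤n⇒m<n∨m≡n σe≤σd
  ...   | inj₂ σe≡σd = λ M → begin
    det (permuteColumns M σ)         ≈⟨ vanishes M ⟩
    0#                               ≈⟨ zeroˡ _ ⟨
    0# * det M                       ≈⟨ *-congʳ (vanishes 𝟙) ⟨
    det (permuteColumns 𝟙 σ) * det M ∎
    where
    vanishes : ∀ M → det (permuteColumns M σ) ≈ 0#
    vanishes M = det-equalAdjacentColumns a (permuteColumns M σ) (λ i → ≡⇒≈ (P.cong (M i) (P.sym (toℕ-injective σe≡σd))))
  ...   | inj₁ σe<σd = λ M → begin
    det (permuteColumns M σ)            ≈⟨ swapNegates M ⟩
    - det (permuteColumns M σ′)         ≈⟨ -‿cong (permutationSign-acc σ′ (smaller measureDecreases) M) ⟩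
    - (det (permuteColumns 𝟙 σ′) * det M) ≈⟨ -‿distribˡ-* _ _ ⟩
    - det (permuteColumns 𝟙 σ′) * det M ≈⟨ *-congʳ (swapNegates 𝟙) ⟨
    det (permuteColumns 𝟙 σ) * det M    ∎
    where
    σ′ : Fin (suc (suc k)) → Fin (suc (suc k))
    σ′ j = σ (swap a j)
    measureDecreases : _ ℕ.∸ sortedness σ′ ℕ.< _ ℕ.∸ sortedness σ
    measureDecreases = ℕₚ.∸-monoʳ-< (sortedness-swap a σ σe<σd) (sortedness-bound σ′)
    swapNegates : ∀ M → det (permuteColumns M σ) ≈ - det (permuteColumns M σ′)
    swapNegates M = det-swapAdjacentColumns a (permuteColumns M σ′) (permuteColumns M σ)
      (λ i → ≡⇒≈ (P.cong (λ q → M i (σ q)) (P.sym (swap-e a))))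
      (λ i → ≡⇒≈ (P.cong (λ q → M i (σ q)) (P.sym (swap-d a))))
      (λ i j j≢d j≢e → ≡⇒≈ (P.cong (λ q → M i (σ q)) (P.sym (swap-outside a j j≢d j≢e))))

  permutationSign : ∀ {m} (σ : Fin m → Fin m) → PermutationSign σ
  permutationSign {zero}        σ M = sym (*-identityˡ 1#)
  permutationSign {suc zero}    σ   = permutationSign-id σ λ { zero → fin1-zero (σ zero) }
    where
    fin1-zero : (j : Fin 1) → j ≡ zero
    fin1-zero zero = P.refl
  permutationSign {suc (suc k)} σ   = permutationSign-acc σ (<-wellFounded _)

  -- Multiplicativity

  sumFunctions : ∀ {m k} → ((Fin k → Fin m) → Carrier) → Carrier
  sumFunctions {m} {zero}  F = F (λ ())
  sumFunctions {m} {suc k} F = sumF {m} (λ a → sumFunctions (λ τ → F (a V.∷ τ)))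

  sumFunctions-cong : ∀ {m k} {F G : (Fin k → Fin m) → Carrier} → (∀ σ → F σ ≈ G σ) → sumFunctions F ≈ sumFunctions G
  sumFunctions-cong {m} {zero}  e = e _
  sumFunctions-cong {m} {suc k} e = sumF-cong (λ a → sumFunctions-cong (λ τ → e (a V.∷ τ)))

  sumFunctions-distribˡ : ∀ {m k} x (F : (Fin k → Fin m) → Carrier) →
                          x * sumFunctions F ≈ sumFunctions (λ σ → x * F σ)
  sumFunctions-distribˡ {m} {zero}  x F = refl
  sumFunctions-distribˡ {m} {suc k} x F =
    trans (sumF-distribˡ {m} x _) (sumF-cong (λ a → sumFunctions-distribˡ x (λ τ → F (a V.∷ τ))))

  prodF : ∀ {k} → (Fin k → Carrier) → Carrier
  prodF {zero}  g = 1#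
  prodF {suc k} g = g zero * prodF (λ j → g (suc j))

  Column : ℕ → Set c
  Column m = Fin m → Carrier

  Congruent : ∀ {m k} → ((Fin k → Column m) → Carrier) → Set (c ⊔ ℓ)
  Congruent G = ∀ X X′ → (∀ j i → X j i ≈ X′ j i) → G X ≈ G X′

  Multilinear : ∀ {m k} → ((Fin k → Column m) → Carrier) → Set (c ⊔ ℓ)
  Multilinear {m} {k} G = ∀ (j : Fin k) (X : Fin k → Column m) (Y : Fin m → Fin k → Column m) (coef : Fin m → Carrier) →
                          (∀ a j′ → ¬ j′ ≡ j → ∀ i → Y a j′ i ≈ X j′ i) →
                          (∀ i → X j i ≈ sumF (λ a → coef a * Y a j i)) →
                          G X ≈ sumF (λ a → coef a * G (Y a))

  multilinear-expand : ∀ {m k} (G : (Fin k → Column m) → Carrier) → Congruent G → Multilinear G →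
                       ∀ (coef : Fin m → Fin k → Carrier) (v : Fin m → Column m) →
                       G (λ j i → sumF (λ a → coef a j * v a i))
                       ≈ sumFunctions {m} {k} (λ σ → prodF (λ j → coef (σ j) j) * G (λ j → v (σ j)))
  multilinear-expand {m} {zero}  G congruent linear coef v = trans (congruent _ _ (λ ())) (sym (*-identityˡ _))
  multilinear-expand {m} {suc k} G congruent linear coef v = begin
    G X
      ≈⟨ linear zero X Y (λ a → coef a zero) (λ { a zero 0≢0 i → ⊥-elim (0≢0 P.refl) ; a (suc j) _ i → refl }) (λ i → refl) ⟩
    sumF (λ a → coef a zero * G (Y a))
      ≈⟨ sumF-cong (λ a → *-congˡ (multilinear-expand (G₀ a) (congruent₀ a) (linear₀ a) (λ b j → coef b (suc j)) v)) ⟩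
    sumF (λ a → coef a zero * sumFunctions (λ τ → prodF (λ j → coef (τ j) (suc j)) * G₀ a (λ j → v (τ j))))
      ≈⟨ sumF-cong (λ a → trans (sumFunctions-distribˡ {m} {k} (coef a zero) _)
                              (sumFunctions-cong {m} {k} (λ τ → trans (sym (*-assoc _ _ _))
                                (*-congˡ (congruent _ _ (λ { zero i → refl ; (suc j) i → refl })))))) ⟩
    sumF (λ a → sumFunctions (λ τ → prodF (λ j → coef ((a V.∷ τ) j) j) * G (λ j → v ((a V.∷ τ) j)))) ∎
    where
    X : Fin (suc k) → Column m
    X j i = sumF (λ a → coef a j * v a i)
    Y : Fin m → Fin (suc k) → Column m
    Y a = v a V.∷ λ j → X (suc j)
    G₀ : Fin m → (Fin k → Column m) → Carrier
    G₀ a T = G (v a V.∷ T)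
    congruent₀ : ∀ a → Congruent (G₀ a)
    congruent₀ a T T′ T≈T′ = congruent _ _ (λ { zero i → refl ; (suc j) i → T≈T′ j i })
    linear₀ : ∀ a → Multilinear (G₀ a)
    linear₀ a j T Z coef′ Z≈T T≈ΣZ = linear (suc j) (v a V.∷ T) (λ b → v a V.∷ Z b) coef′
      (λ { b zero _ i → refl ; b (suc j′) j′≢j i → Z≈T b j′ (λ x → j′≢j (P.cong suc x)) i }) T≈ΣZ

  detOfColumns : ∀ {m} → (Fin m → Column m) → Carrier
  detOfColumns cols = det (λ i j → cols j i)

  detOfColumns-multilinear : ∀ {m} → Multilinear (detOfColumns {m})
  detOfColumns-multilinear j X Y coef Y≈X X≈ΣY =
    det-linearInColumn (λ i j → X j i) (λ a i j → Y a j i) coef j (λ a i j′ j′≢j → Y≈X a j′ j′≢j i) X≈ΣY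

  det-expandProduct : ∀ {m} (M N : Mat m) →
                      det (λ i j → sumF (λ a → M i a * N a j))
                      ≈ sumFunctions {m} {m} (λ σ → prodF (λ j → N (σ j) j) * det (permuteColumns M σ))
  det-expandProduct {m} M N =
    trans (det-cong {m} (λ i j → sumF-cong {m} (λ a → *-comm (M i a) (N a j))))
          (multilinear-expand detOfColumns (λ X X′ X≈X′ → det-cong (λ i j → X≈X′ j i)) detOfColumns-multilinear
                              N (λ a i → M i a))

  det-product : ∀ {m} (M N : Mat m) → det (λ i j → sumF (λ a → M i a * N a j)) ≈ det M * det N
  det-product {m} M N = begin
    det (λ i j → sumF (λ a → M i a * N a j))
      ≈⟨ det-expandProduct M N ⟩
    sumFunctions (λ σ → prodF (λ j → N (σ j) j) * det (permuteColumns M σ))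
      ≈⟨ sumFunctions-cong {m} {m} (λ σ → *-congˡ (permutationSign σ M)) ⟩
    sumFunctions (λ σ → prodF (λ j → N (σ j) j) * (det (permuteColumns 𝟙 σ) * det M))
      ≈⟨ sumFunctions-cong {m} {m} (λ σ → solve 3 (λ a b c → a :* (b :* c) := c :* (a :* b)) refl _ _ _) ⟩
    sumFunctions (λ σ → det M * (prodF (λ j → N (σ j) j) * det (permuteColumns 𝟙 σ)))
      ≈⟨ sumFunctions-distribˡ {m} {m} (det M) _ ⟨
    det M * sumFunctions (λ σ → prodF (λ j → N (σ j) j) * det (permuteColumns 𝟙 σ))
      ≈⟨ *-congˡ (det-expandProduct 𝟙 N) ⟨
    det M * det (λ i j → sumF (λ a → 𝟙 i a * N a j))
      ≈⟨ *-congˡ (det-cong (λ i j → sumF-δᶠ i (λ a → N a j))) ⟩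
    det M * det N ∎

  det-unitFirstColumn : ∀ {m} (N : Mat (suc m)) (a : Fin (suc m)) → (∀ i → N i zero ≈ δ (toℕ i) (toℕ a)) →
                        det N ≈ alt (toℕ a) (det (λ r s → N (punchIn a r) (suc s)))
  det-unitFirstColumn {m} N zero N₀≈δ = begin
    expansionTerm N zero + sumF (λ k → expansionTerm N (suc k))
      ≈⟨ +-cong (trans (*-congʳ (N₀≈δ zero)) (*-identityˡ _)) (sumF-zero {m} _ (otherTermsVanish m N N₀≈δ)) ⟩
    det (λ r s → N (suc r) (suc s)) + 0#
      ≈⟨ +-identityʳ _ ⟩
    det (λ r s → N (suc r) (suc s)) ∎
    where
    otherTermsVanish : ∀ m (N : Mat (suc m)) → (∀ i → N i zero ≈ δ (toℕ i) 0) → ∀ k → expansionTerm N (suc k) ≈ 0#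
    otherTermsVanish (suc m) N N₀≈δ k =
      trans (alt-cong (toℕ (suc k)) (trans (*-congˡ (det-zeroColumn (minor (suc k) N) zero (λ i → N₀≈δ (suc i)))) (zeroʳ _)))
            (alt-zero (toℕ (suc k)))
  det-unitFirstColumn {suc m} N (suc a) N₀≈δ = begin
    expansionTerm N zero + sumF (λ k → expansionTerm N (suc k))
      ≈⟨ +-cong firstTermVanishes (sumF-cong otherTerm) ⟩
    0# + sumF (λ k → - alt (toℕ a) (alt (toℕ k) (N zero (suc k) * D k)))
      ≈⟨ +-identityˡ _ ⟩
    sumF (λ k → - alt (toℕ a) (alt (toℕ k) (N zero (suc k) * D k)))
      ≈⟨ sumF-neg {suc m} (λ k → alt (toℕ a) (alt (toℕ k) (N zero (suc k) * D k))) ⟨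
    - sumF (λ k → alt (toℕ a) (alt (toℕ k) (N zero (suc k) * D k)))
      ≈⟨ -‿cong (alt-sumF {suc m} (toℕ a) (λ k → alt (toℕ k) (N zero (suc k) * D k))) ⟨
    - alt (toℕ a) (sumF (λ k → alt (toℕ k) (N zero (suc k) * D k))) ∎
    where
    D : Fin (suc m) → Carrier
    D k = det (λ r s → N (suc (punchIn a r)) (suc (punchIn k s)))
    firstTermVanishes : expansionTerm N zero ≈ 0#
    firstTermVanishes = trans (*-congʳ (N₀≈δ zero)) (zeroˡ _)
    otherTerm : ∀ k → expansionTerm N (suc k) ≈ - alt (toℕ a) (alt (toℕ k) (N zero (suc k) * D k))
    otherTerm k = begin
      - alt (toℕ k) (N zero (suc k) * det (minor (suc k) N))
        ≈⟨ -‿cong (alt-cong (toℕ k) (*-congˡ (det-unitFirstColumn (minor (suc k) N) a (λ i → N₀≈δ (suc i))))) ⟩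
      - alt (toℕ k) (N zero (suc k) * alt (toℕ a) (D k))
        ≈⟨ -‿cong (alt-cong (toℕ k) (alt-*ˡ (toℕ a) _ _)) ⟨
      - alt (toℕ k) (alt (toℕ a) (N zero (suc k) * D k))
        ≈⟨ -‿cong (alt-comm (toℕ k) (toℕ a) _) ⟩
      - alt (toℕ a) (alt (toℕ k) (N zero (suc k) * D k)) ∎

  det-firstColumnExpansion : ∀ {m} (M : Mat (suc m)) →
                             det M ≈ sumF (λ a → alt (toℕ a) (M a zero * det (λ r s → M (punchIn a r) (suc s))))
  det-firstColumnExpansion {m} M = begin
    det M
      ≈⟨ det-linearInColumn M unitColumn (λ a → M a zero) zero unitColumn≈M M≈ΣunitColumn ⟩
    sumF (λ a → M a zero * det (unitColumn a))
      ≈⟨ sumF-cong {suc m} (λ a → trans (*-congˡ {M a zero} (det-unitFirstColumn (unitColumn a) a (λ i → refl)))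
                                         (sym (alt-*ˡ (toℕ a) _ _))) ⟩
    sumF (λ a → alt (toℕ a) (M a zero * det (λ r s → M (punchIn a r) (suc s)))) ∎
    where
    unitColumn : Fin (suc m) → Mat (suc m)
    unitColumn a i zero    = δ (toℕ i) (toℕ a)
    unitColumn a i (suc j) = M i (suc j)
    unitColumn≈M : ∀ a i j → ¬ j ≡ zero → unitColumn a i j ≈ M i j
    unitColumn≈M a i zero    0≢0 = ⊥-elim (0≢0 P.refl)
    unitColumn≈M a i (suc j) _   = refl
    M≈ΣunitColumn : ∀ i → M i zero ≈ sumF (λ a → M a zero * unitColumn a i zero)
    M≈ΣunitColumn i = sym (trans (sumF-cong {suc m} (λ a → *-comm (M a zero) (unitColumn a i zero))) (sumF-δᶠ i (λ a → M a zero)))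

  det-transpose : ∀ {m} (M : Mat m) → det (λ i j → M j i) ≈ det M
  det-transpose {zero}  M = refl
  det-transpose {suc m} M = begin
    sumF (λ j → alt (toℕ j) (M j zero * det (λ r s → M (punchIn j s) (suc r))))
      ≈⟨ sumF-cong {suc m} (λ j → alt-cong (toℕ j) (*-congˡ {M j zero} (det-transpose (λ r s → M (punchIn j r) (suc s))))) ⟩
    sumF (λ j → alt (toℕ j) (M j zero * det (λ r s → M (punchIn j r) (suc s))))
      ≈⟨ det-firstColumnExpansion M ⟨
    det M ∎

  -- Difference operators on sequences indexed by ℤ

  Seq : Set c
  Seq = ℤ → Carrier

  hs : List Carrier → Seq
  hs L (+ k)    = hh L k
  hs L -[1+ k ] = 0#

  -- Δ y multiplies the generating function Σ φ(p) wᵖ by 1 - y w.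
  Δ : Carrier → Seq → Seq
  Δ y φ p = φ p - y * φ (p ℤ.- + 1)

  VanishesOnNegatives : Seq → Set ℓ
  VanishesOnNegatives φ = ∀ k → φ -[1+ k ] ≈ 0#

  hh-zero : ∀ L → hh L 0 ≈ 1#
  hh-zero []      = refl
  hh-zero (y ∷ L) = trans (+-identityʳ _) (trans (*-identityˡ _) (hh-zero L))

  hh-suc : ∀ y L k → hh (y ∷ L) (suc k) ≈ hh L (suc k) + y * hh (y ∷ L) k
  hh-suc y L k = +-cong (*-identityˡ _)
    (trans (sumF-cong {suc k} (λ j → *-assoc y (pow y (toℕ j)) (hh L (k ℕ.∸ toℕ j))))
           (sym (sumF-distribˡ {suc k} y (λ j → pow y (toℕ j) * hh L (k ℕ.∸ toℕ j)))))

  Δ-cong : ∀ y {φ ψ : Seq} → (∀ p → φ p ≈ ψ p) → ∀ p → Δ y φ p ≈ Δ y ψ p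
  Δ-cong y φ≈ψ p = +-cong (φ≈ψ p) (-‿cong (*-congˡ (φ≈ψ (p ℤ.- + 1))))

  Δ-comm : ∀ a b φ p → Δ a (Δ b φ) p ≈ Δ b (Δ a φ) p
  Δ-comm a b φ p =
    solve 5 (λ a b x y z → (x :- b :* y) :- a :* (y :- b :* z) := (x :- a :* y) :- b :* (y :- a :* z)) refl a b _ _ _

  Δ-vanishesOnNegatives : ∀ y φ → VanishesOnNegatives φ → VanishesOnNegatives (Δ y φ)
  Δ-vanishesOnNegatives y φ φ₋≈0 k =
    trans (+-cong (φ₋≈0 k) (-‿cong (*-congˡ (φ₋≈0 _)))) (solve 1 (λ y → con (+ 0) :- y :* con (+ 0) := con (+ 0)) refl y)

  -- Induction upwards from φ(-1) = ψ(-1) = 0.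
  Δ-injective : ∀ a φ ψ → VanishesOnNegatives φ → VanishesOnNegatives ψ →
                (∀ p → Δ a φ p ≈ Δ a ψ p) → ∀ p → φ p ≈ ψ p
  Δ-injective a φ ψ φ₋≈0 ψ₋≈0 Δφ≈Δψ -[1+ k ] = trans (φ₋≈0 k) (sym (ψ₋≈0 k))
  Δ-injective a φ ψ φ₋≈0 ψ₋≈0 Δφ≈Δψ (+ k)    = onNaturals k
    where
    cancel : ∀ x y x′ y′ → x - a * y ≈ x′ - a * y′ → y ≈ y′ → x ≈ x′
    cancel x y x′ y′ Δ≈ y≈y′ = begin
      x                   ≈⟨ solve 3 (λ x a y → x := (x :- a :* y) :+ a :* y) refl x a y ⟩
      (x - a * y) + a * y    ≈⟨ +-cong Δ≈ (*-congˡ y≈y′) ⟩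
      (x′ - a * y′) + a * y′ ≈⟨ solve 3 (λ x a y → (x :- a :* y) :+ a :* y := x) refl x′ a y′ ⟩
      x′                  ∎
    onNaturals : ∀ k → φ (+ k) ≈ ψ (+ k)
    onNaturals zero    = cancel _ _ _ _ (Δφ≈Δψ (+ 0)) (trans (φ₋≈0 0) (sym (ψ₋≈0 0)))
    onNaturals (suc k) = cancel _ _ _ _ (Δφ≈Δψ (+ suc k)) (onNaturals k)

  Δ-hs-head : ∀ y L p → Δ y (hs (y ∷ L)) p ≈ hs L p
  Δ-hs-head y L (+ zero)  = trans (+-cong (hh-zero (y ∷ L)) (-‿cong (zeroʳ y)))
                                  (trans (solve 1 (λ o → o :- con (+ 0) := o) refl 1#) (sym (hh-zero L)))
  Δ-hs-head y L (+ suc k) = trans (+-congʳ (hh-suc y L k)) (solve 2 (λ a b → a :+ b :- b := a) refl _ _)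
  Δ-hs-head y L -[1+ k ]  = solve 1 (λ y → con (+ 0) :- y :* con (+ 0) := con (+ 0)) refl y

  data Remove (y : Carrier) : List Carrier → List Carrier → Set c where
    here  : ∀ {L} → Remove y (y ∷ L) L
    there : ∀ {a L L′} → Remove y L L′ → Remove y (a ∷ L) (a ∷ L′)

  Δ-hs : ∀ {y L L′} → Remove y L L′ → ∀ p → Δ y (hs L) p ≈ hs L′ p
  Δ-hs {y} here = Δ-hs-head y _
  Δ-hs {y} (there {a} {L} {L′} r) =
    Δ-injective a (Δ y (hs (a ∷ L))) (hs (a ∷ L′)) (Δ-vanishesOnNegatives y (hs (a ∷ L)) (λ _ → refl)) (λ _ → refl) ΔaΔy≈Δa
    where
    ΔaΔy≈Δa : ∀ p → Δ a (Δ y (hs (a ∷ L))) p ≈ Δ a (hs (a ∷ L′)) p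
    ΔaΔy≈Δa p = begin
      Δ a (Δ y (hs (a ∷ L))) p ≈⟨ Δ-comm a y (hs (a ∷ L)) p ⟩
      Δ y (Δ a (hs (a ∷ L))) p ≈⟨ Δ-cong y (Δ-hs-head a L) p ⟩
      Δ y (hs L) p             ≈⟨ Δ-hs r p ⟩
      hs L′ p                  ≈⟨ Δ-hs-head a L′ p ⟨
      Δ a (hs (a ∷ L′)) p      ∎

  Pairs : Set c
  Pairs = List (Carrier × Carrier)

  iterΔ : Pairs → Seq → Seq
  iterΔ []             φ = φ
  iterΔ ((a , b) ∷ ps) φ = Δ b (Δ a (iterΔ ps φ))

  data RemovePairs : Pairs → List Carrier → List Carrier → Set c where
    []  : ∀ {L} → RemovePairs [] L L
    _∷_ : ∀ {a b ps L L₁ L₂ L₃} → Remove a L₁ L₂ × Remove b L₂ L₃ → RemovePairs ps L L₁ →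
          RemovePairs ((a , b) ∷ ps) L L₃

  iterΔ-hs : ∀ {ps L L′} → RemovePairs ps L L′ → ∀ p → iterΔ ps (hs L) p ≈ hs L′ p
  iterΔ-hs []                         p = refl
  iterΔ-hs (_∷_ {a} {b} {ps} {L} {L₁} {L₂} {L₃} (ra , rb) rs) p = begin
    Δ b (Δ a (iterΔ ps (hs L))) p ≈⟨ Δ-cong b (Δ-cong a (iterΔ-hs rs)) p ⟩
    Δ b (Δ a (hs L₁)) p           ≈⟨ Δ-cong b (Δ-hs ra) p ⟩
    Δ b (hs L₂) p                 ≈⟨ Δ-hs rb p ⟩
    hs L₃ p                       ∎

  T : Carrier → Seq → Seq
  T t φ p = φ (p ℤ.+ + 1) + φ (p ℤ.- + 1) - t * φ p

  T-cong : ∀ t {φ ψ : Seq} → (∀ p → φ p ≈ ψ p) → ∀ p → T t φ p ≈ T t ψ p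
  T-cong t φ≈ψ p = +-cong (+-cong (φ≈ψ _) (φ≈ψ _)) (-‿cong (*-congˡ (φ≈ψ p)))

  iterT : Pairs → Seq → Seq
  iterT []             φ = φ
  iterT ((a , b) ∷ ps) φ = T (a + b) (iterT ps φ)

  iterT-cong : ∀ ps {φ ψ : Seq} → (∀ p → φ p ≈ ψ p) → ∀ p → iterT ps φ p ≈ iterT ps ψ p
  iterT-cong []             φ≈ψ = φ≈ψ
  iterT-cong ((a , b) ∷ ps) φ≈ψ = T-cong (a + b) (iterT-cong ps φ≈ψ)

  Inverses : Pairs → Set ℓ
  Inverses []             = ⊤
  Inverses ((a , b) ∷ ps) = (a * b ≈ 1#) × Inverses ps

  -- w + w⁻¹ - (a + b) = w⁻¹ (1 - a w)(1 - b w) when a b = 1.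
  T-ΔΔ : ∀ a b → a * b ≈ 1# → ∀ φ p → T (a + b) φ p ≈ Δ b (Δ a φ) (p ℤ.+ + 1)
  T-ΔΔ a b ab≈1 φ p = begin
    φ (p ℤ.+ + 1) + φ (p ℤ.- + 1) - (a + b) * φ p
      ≈⟨ +-congʳ (+-congˡ (sym (*-identityˡ _))) ⟩
    φ (p ℤ.+ + 1) + 1# * φ (p ℤ.- + 1) - (a + b) * φ p
      ≈⟨ solve 6 (λ o a b x y z → x :+ o :* y :- (a :+ b) :* z := (x :- a :* z) :- b :* (z :- a :* y) :+ (o :- a :* b) :* y)
                 refl 1# a b _ _ _ ⟩
    (φ (p ℤ.+ + 1) - a * φ p) - b * (φ p - a * φ (p ℤ.- + 1)) + (1# - a * b) * φ (p ℤ.- + 1)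
      ≈⟨ +-congˡ (*-congʳ (trans (+-congˡ (-‿cong ab≈1)) (-‿inverseʳ 1#))) ⟩
    (φ (p ℤ.+ + 1) - a * φ p) - b * (φ p - a * φ (p ℤ.- + 1)) + 0# * φ (p ℤ.- + 1)
      ≈⟨ trans (+-congˡ (zeroˡ _)) (+-identityʳ _) ⟩
    (φ (p ℤ.+ + 1) - a * φ p) - b * (φ p - a * φ (p ℤ.- + 1))
      ≈⟨ +-cong (+-congˡ (-‿cong (*-congˡ (at (IndexArithmetic.p+1-1≡p p)))))
                (-‿cong (*-congˡ (+-cong (at (IndexArithmetic.p+1-1≡p p)) (-‿cong (*-congˡ (at (IndexArithmetic.p+1-1-1≡p-1 p))))))) ⟨
    Δ b (Δ a φ) (p ℤ.+ + 1) ∎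
    where
    at : ∀ {q q′} → q ≡ q′ → φ q ≈ φ q′
    at e = ≡⇒≈ (P.cong φ e)

  Δ-shift : ∀ y (ψ : Seq) s p → Δ y (λ q → ψ (q ℤ.+ s)) p ≈ Δ y ψ (p ℤ.+ s)
  Δ-shift y ψ s p = +-congˡ (-‿cong (*-congˡ (≡⇒≈ (P.cong ψ (IndexArithmetic.p-1+s≡p+s-1 p s)))))

  iterT-iterΔ : ∀ ps → Inverses ps → ∀ φ p → iterT ps φ p ≈ iterΔ ps φ (p ℤ.+ + length ps)
  iterT-iterΔ []             _              φ p = ≡⇒≈ (P.cong φ (P.sym (ℤₚ.+-identityʳ p)))
  iterT-iterΔ ((a , b) ∷ ps) (ab≈1 , inverses) φ p = begin
    T (a + b) (iterT ps φ) p                           ≈⟨ T-cong (a + b) (iterT-iterΔ ps inverses φ) p ⟩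
    T (a + b) (λ q → ψ (q ℤ.+ + length ps)) p          ≈⟨ T-ΔΔ a b ab≈1 (λ q → ψ (q ℤ.+ + length ps)) p ⟩
    Δ b (Δ a (λ q → ψ (q ℤ.+ + length ps))) (p ℤ.+ + 1) ≈⟨ Δ-cong b (Δ-shift a ψ (+ length ps)) (p ℤ.+ + 1) ⟩
    Δ b (λ q → Δ a ψ (q ℤ.+ + length ps)) (p ℤ.+ + 1)   ≈⟨ Δ-shift b (Δ a ψ) (+ length ps) (p ℤ.+ + 1) ⟩
    Δ b (Δ a ψ) (p ℤ.+ + 1 ℤ.+ + length ps)            ≈⟨ ≡⇒≈ (P.cong (Δ b (Δ a ψ)) (ℤₚ.+-assoc p (+ 1) (+ length ps))) ⟩
    Δ b (Δ a ψ) (p ℤ.+ + suc (length ps))              ∎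
    where
    ψ = iterΔ ps φ

  -- The span of the Jacobi–Trudi entries

  module JacobiTrudiSpan (h : Seq) where

    jtEntry : ℕ → Seq
    jtEntry zero    p = h p
    jtEntry (suc k) p = h (p ℤ.+ + suc k) + h (p ℤ.- + suc k)

    InSpan : ℕ → Seq → Set (c ⊔ ℓ)
    InSpan N φ = Σ (Fin (suc N) → Carrier) λ coef → ∀ p → φ p ≈ sumF (λ k → coef k * jtEntry (toℕ k) p)

    jtEntry-inSpan : ∀ N k → k ℕ.≤ N → InSpan N (jtEntry k)
    jtEntry-inSpan N k k≤N = (λ j → δ (toℕ j) k) , λ p → sym (sumF-δ (λ t → jtEntry t p) k (s≤s k≤N))

    InSpan-resp : ∀ {N φ ψ} → InSpan N φ → (∀ p → ψ p ≈ φ p) → InSpan N ψ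
    InSpan-resp (coef , φ≈) ψ≈φ = coef , λ p → trans (ψ≈φ p) (φ≈ p)

    InSpan-sum : ∀ {N q} (w : Fin q → Carrier) (ψ : Fin q → Seq) → (∀ i → InSpan N (ψ i)) →
                 InSpan N (λ p → sumF (λ i → w i * ψ i p))
    InSpan-sum {N} {q} w ψ inSpan = (λ k → sumF (λ i → w i * coef i k)) , λ p → begin
      sumF (λ i → w i * ψ i p)
        ≈⟨ sumF-cong {q} (λ i → *-congˡ (proj₂ (inSpan i) p)) ⟩
      sumF (λ i → w i * sumF (λ k → coef i k * jtEntry (toℕ k) p))
        ≈⟨ sumF-cong {q} (λ i → sumF-distribˡ {suc N} (w i) (λ k → coef i k * jtEntry (toℕ k) p)) ⟩
      sumF (λ i → sumF (λ k → w i * (coef i k * jtEntry (toℕ k) p)))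
        ≈⟨ sumF-comm {q} {suc N} (λ i k → w i * (coef i k * jtEntry (toℕ k) p)) ⟩
      sumF (λ k → sumF (λ i → w i * (coef i k * jtEntry (toℕ k) p)))
        ≈⟨ sumF-cong {suc N} (λ k → trans (sumF-cong {q} (λ i → sym (*-assoc (w i) (coef i k) (jtEntry (toℕ k) p))))
                                          (sym (sumF-distribʳ {q} (jtEntry (toℕ k) p) (λ i → w i * coef i k)))) ⟩
      sumF (λ k → sumF (λ i → w i * coef i k) * jtEntry (toℕ k) p) ∎
      where
      coef : Fin q → Fin (suc N) → Carrier
      coef i = proj₁ (inSpan i)

    InSpan-combination₂ : ∀ {N φ₁ φ₂} a₁ a₂ → InSpan N φ₁ → InSpan N φ₂ → InSpan N (λ p → a₁ * φ₁ p + a₂ * φ₂ p)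
    InSpan-combination₂ {N} {φ₁} {φ₂} a₁ a₂ s₁ s₂ =
      InSpan-resp (InSpan-sum (a₁ V.∷ a₂ V.∷ V.[]) (φ₁ V.∷ φ₂ V.∷ V.[]) λ { zero → s₁ ; (suc zero) → s₂ })
                  (λ p → +-congˡ (sym (+-identityʳ _)))

    InSpan-combination₃ : ∀ {N φ₁ φ₂ φ₃} a₁ a₂ a₃ → InSpan N φ₁ → InSpan N φ₂ → InSpan N φ₃ →
                          InSpan N (λ p → a₁ * φ₁ p + a₂ * φ₂ p + a₃ * φ₃ p)
    InSpan-combination₃ {N} {φ₁} {φ₂} {φ₃} a₁ a₂ a₃ s₁ s₂ s₃ =
      InSpan-resp (InSpan-sum (a₁ V.∷ a₂ V.∷ a₃ V.∷ V.[]) (φ₁ V.∷ φ₂ V.∷ φ₃ V.∷ V.[])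
                              λ { zero → s₁ ; (suc zero) → s₂ ; (suc (suc zero)) → s₃ })
                  (λ p → solve 3 (λ x y z → x :+ y :+ z := x :+ (y :+ (z :+ con (+ 0)))) refl _ _ _)

    -- T t c₀ = c₁ - t c₀,  T t c₁ = c₂ + 2 c₀ - t c₁,  T t c_{k+2} = c_{k+3} + c_{k+1} - t c_{k+2}.
    T-jtEntry-inSpan : ∀ N t k → k ℕ.≤ N → InSpan (suc N) (T t (jtEntry k))
    T-jtEntry-inSpan N t zero _ =
      InSpan-resp (InSpan-combination₂ 1# (- t) (jtEntry-inSpan (suc N) 1 (s≤s z≤n)) (jtEntry-inSpan (suc N) 0 z≤n))
        (λ p → trans (solve 3 (λ x t z → x :- t :* z := x :+ (:- t) :* z) refl (jtEntry 1 p) t (h p))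
                     (+-congʳ (sym (*-identityˡ _))))
    T-jtEntry-inSpan N t (suc zero) 1≤N =
      InSpan-resp (InSpan-combination₃ 1# (1# + 1#) (- t) (jtEntry-inSpan (suc N) 2 (s≤s 1≤N))
                                       (jtEntry-inSpan (suc N) 0 z≤n) (jtEntry-inSpan (suc N) 1 (s≤s z≤n)))
        λ p → begin
          (h (p ℤ.+ + 1 ℤ.+ + 1) + h (p ℤ.+ + 1 ℤ.- + 1)) + (h (p ℤ.- + 1 ℤ.+ + 1) + h (p ℤ.- + 1 ℤ.- + 1)) - t * jtEntry 1 p
            ≈⟨ +-congʳ (+-cong (+-cong (at (ℤₚ.+-assoc p (+ 1) (+ 1))) (at (IndexArithmetic.p+1-1≡p p)))
                               (+-cong (at (P.trans (ℤₚ.+-assoc p -[1+ 0 ] (+ 1)) (ℤₚ.+-identityʳ p)))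
                                       (at (ℤₚ.+-assoc p -[1+ 0 ] -[1+ 0 ])))) ⟩
          (h (p ℤ.+ + 2) + h p) + (h p + h (p ℤ.- + 2)) - t * jtEntry 1 p
            ≈⟨ solve 5 (λ a b c t d → (a :+ b) :+ (b :+ c) :- t :* d := (a :+ c) :+ (b :+ b) :+ (:- t) :* d) refl _ _ _ t _ ⟩
          jtEntry 2 p + (h p + h p) + (- t) * jtEntry 1 p
            ≈⟨ +-congʳ (+-cong (sym (*-identityˡ _)) (sym (trans (distribʳ _ 1# 1#) (+-cong (*-identityˡ _) (*-identityˡ _))))) ⟩
          1# * jtEntry 2 p + (1# + 1#) * jtEntry 0 p + (- t) * jtEntry 1 p ∎
      where
      at : ∀ {q q′} → q ≡ q′ → h q ≈ h q′
      at e = ≡⇒≈ (P.cong h e)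
    T-jtEntry-inSpan N t (suc (suc k)) k+2≤N =
      InSpan-resp (InSpan-combination₃ 1# 1# (- t) (jtEntry-inSpan (suc N) (3 ℕ.+ k) (s≤s k+2≤N))
                    (jtEntry-inSpan (suc N) (suc k) (ℕₚ.≤-trans (ℕₚ.n≤1+n _) (ℕₚ.≤-trans k+2≤N (ℕₚ.n≤1+n _))))
                    (jtEntry-inSpan (suc N) (suc (suc k)) (ℕₚ.≤-trans k+2≤N (ℕₚ.n≤1+n _))))
        λ p → begin
          (h (p ℤ.+ + 1 ℤ.+ + suc (suc k)) + h (p ℤ.+ + 1 ℤ.- + suc (suc k)))
            + (h (p ℤ.- + 1 ℤ.+ + suc (suc k)) + h (p ℤ.- + 1 ℤ.- + suc (suc k))) - t * jtEntry (suc (suc k)) p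
            ≈⟨ +-congʳ (+-cong (+-cong (at (ℤₚ.+-assoc p (+ 1) (+ suc (suc k)))) (at (ℤₚ.+-assoc p (+ 1) -[1+ suc k ])))
                               (+-cong (at (ℤₚ.+-assoc p -[1+ 0 ] (+ suc (suc k)))) (at (ℤₚ.+-assoc p -[1+ 0 ] -[1+ suc k ])))) ⟩
          (h (p ℤ.+ + suc (suc (suc k))) + h (p ℤ.- + suc k))
            + (h (p ℤ.+ + suc k) + h (p ℤ.- + suc (suc (suc k)))) - t * jtEntry (suc (suc k)) p
            ≈⟨ solve 6 (λ a b c d t e → (a :+ b) :+ (c :+ d) :- t :* e := (a :+ d) :+ (c :+ b) :+ (:- t) :* e) refl _ _ _ _ t _ ⟩
          jtEntry (3 ℕ.+ k) p + jtEntry (suc k) p + (- t) * jtEntry (suc (suc k)) p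
            ≈⟨ +-congʳ (+-cong (sym (*-identityˡ _)) (sym (*-identityˡ _))) ⟩
          1# * jtEntry (3 ℕ.+ k) p + 1# * jtEntry (suc k) p + (- t) * jtEntry (suc (suc k)) p ∎
      where
      at : ∀ {q q′} → q ≡ q′ → h q ≈ h q′
      at e = ≡⇒≈ (P.cong h e)

    T-inSpan : ∀ N t φ → InSpan N φ → InSpan (suc N) (T t φ)
    T-inSpan N t φ (coef , φ≈) =
      InSpan-resp (InSpan-sum coef (λ k → T t (jtEntry (toℕ k))) (λ k → T-jtEntry-inSpan N t (toℕ k) (ℕ.s≤s⁻¹ (toℕ<n k))))
        λ p → begin
          φ (p ℤ.+ + 1) + φ (p ℤ.- + 1) - t * φ p
            ≈⟨ +-cong (+-cong (φ≈ _) (φ≈ _)) (-‿cong (*-congˡ (φ≈ p))) ⟩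
          expanded (p ℤ.+ + 1) + expanded (p ℤ.- + 1) - t * expanded p
            ≈⟨ +-cong (sym (sumF-+ {suc N} (term (p ℤ.+ + 1)) (term (p ℤ.- + 1))))
                      (trans (-‿cong (sumF-distribˡ {suc N} t (term p))) (sumF-neg {suc N} (λ k → t * term p k))) ⟩
          sumF (λ k → term (p ℤ.+ + 1) k + term (p ℤ.- + 1) k) + sumF (λ k → - (t * term p k))
            ≈⟨ sumF-+ {suc N} (λ k → term (p ℤ.+ + 1) k + term (p ℤ.- + 1) k) (λ k → - (t * term p k)) ⟨
          sumF (λ k → (term (p ℤ.+ + 1) k + term (p ℤ.- + 1) k) + - (t * term p k))
            ≈⟨ sumF-cong {suc N} (λ k → solve 5 (λ m x y t z → (m :* x :+ m :* y) :+ (:- (t :* (m :* z))) := m :* (x :+ y :- t :* z))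
                                                refl (coef k) (jtEntry (toℕ k) (p ℤ.+ + 1)) (jtEntry (toℕ k) (p ℤ.- + 1)) t (jtEntry (toℕ k) p)) ⟩
          sumF (λ k → coef k * T t (jtEntry (toℕ k)) p) ∎
      where
      term : ℤ → Fin (suc N) → Carrier
      term q k = coef k * jtEntry (toℕ k) q
      expanded : Seq
      expanded q = sumF (term q)

    iterT-inSpan : ∀ ps → InSpan (length ps) (iterT ps h)
    iterT-inSpan []             = jtEntry-inSpan 0 0 z≤n
    iterT-inSpan ((a , b) ∷ ps) = T-inSpan (length ps) (a + b) (iterT ps h) (iterT-inSpan ps)

  powDiff : Carrier → Carrier → ℕ → Carrier
  powDiff y yinv e = ipow y yinv (+ e) - ipow y yinv (ℤ.- (+ e))

  powDiff-pred : ∀ y yinv e m → e ≡ suc m → ipow y yinv (+ e ℤ.- + 1) - ipow y yinv (ℤ.- (+ e ℤ.- + 1)) ≈ powDiff y yinv m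
  powDiff-pred y yinv .(suc m) m P.refl = refl

  ipow-neg : ∀ y yinv k → ipow y yinv (ℤ.- (+ k)) ≈ pow yinv k
  ipow-neg y yinv zero    = refl
  ipow-neg y yinv (suc k) = refl

  hh-single : ∀ y k → hh (y ∷ []) k ≈ pow y k
  hh-single y zero    = hh-zero (y ∷ [])
  hh-single y (suc k) = trans (hh-suc y [] k) (trans (+-identityˡ _) (*-congˡ (hh-single y k)))

  hh-pair : ∀ a b k → (a - b) * hh (a ∷ b ∷ []) k ≈ pow a (suc k) - pow b (suc k)
  hh-pair a b zero    = trans (*-congˡ (hh-zero (a ∷ b ∷ []))) (solve 3 (λ a b o → (a :- b) :* o := a :* o :- b :* o) refl a b 1#)
  hh-pair a b (suc k) = begin
    (a - b) * hh (a ∷ b ∷ []) (suc k)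
      ≈⟨ *-congˡ (trans (hh-suc a (b ∷ []) k) (+-congʳ (hh-single b (suc k)))) ⟩
    (a - b) * (pow b (suc k) + a * hh (a ∷ b ∷ []) k)
      ≈⟨ solve 4 (λ a b Q H → (a :- b) :* (Q :+ a :* H) := (a :- b) :* Q :+ a :* ((a :- b) :* H)) refl a b _ _ ⟩
    (a - b) * pow b (suc k) + a * ((a - b) * hh (a ∷ b ∷ []) k)
      ≈⟨ +-congˡ (*-congˡ (hh-pair a b k)) ⟩
    (a - b) * pow b (suc k) + a * (pow a (suc k) - pow b (suc k))
      ≈⟨ solve 4 (λ a b P Q → (a :- b) :* Q :+ a :* (P :- Q) := a :* P :- b :* Q) refl a b _ _ ⟩
    pow a (suc (suc k)) - pow b (suc (suc k)) ∎

  hs-pair-pred : ∀ a b k → (a - b) * hs (a ∷ b ∷ []) (+ k ℤ.- + 1) ≈ pow a k - pow b k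
  hs-pair-pred a b zero    = trans (zeroʳ _) (sym (-‿inverseʳ 1#))
  hs-pair-pred a b (suc k) = hh-pair a b k

  xRowEntry : ∀ xi xinv zinv e k → e ≡ suc k →
              powDiff xi xinv e - zinv * (ipow xi xinv (+ e ℤ.- + 1) - ipow xi xinv (ℤ.- (+ e ℤ.- + 1)))
              ≈ (xi - xinv) * Δ zinv (hs (xi ∷ xinv ∷ [])) (+ k)
  xRowEntry xi xinv zinv .(suc k) k P.refl = sym (begin
    (xi - xinv) * (hs H (+ k) - zinv * hs H (+ k ℤ.- + 1))
      ≈⟨ solve 4 (λ a P w Q → a :* (P :- w :* Q) := a :* P :- w :* (a :* Q)) refl (xi - xinv) _ zinv _ ⟩
    (xi - xinv) * hs H (+ k) - zinv * ((xi - xinv) * hs H (+ k ℤ.- + 1))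
      ≈⟨ +-cong (hh-pair xi xinv k) (-‿cong (*-congˡ (trans (hs-pair-pred xi xinv k) (+-congˡ (-‿cong (sym (ipow-neg xi xinv k))))))) ⟩
    (pow xi (suc k) - pow xinv (suc k)) - zinv * (pow xi k - ipow xi xinv (ℤ.- (+ k))) ∎)
    where H = xi ∷ xinv ∷ []

  zRowEntry : ∀ z zinv → zinv * z ≈ 1# → ∀ e k → e ≡ suc k →
              ipow z zinv (+ e) - ipow z zinv (+ e ℤ.- + 2) ≈ (z - zinv) * hs (z ∷ []) (+ k)
  zRowEntry z zinv zinv*z≈1 .(suc zero) zero P.refl =
    sym (trans (*-congˡ (hh-zero (z ∷ []))) (solve 3 (λ a b o → (a :- b) :* o := a :* o :- b :* o) refl z zinv 1#))
  zRowEntry z zinv zinv*z≈1 .(suc (suc k)) (suc k) P.refl = sym (begin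
    (z - zinv) * hh (z ∷ []) (suc k)            ≈⟨ *-congˡ (hh-single z (suc k)) ⟩
    (z - zinv) * (z * pow z k)                  ≈⟨ solve 3 (λ a b P → (a :- b) :* (a :* P) := a :* (a :* P) :- (b :* a) :* P) refl z zinv _ ⟩
    z * (z * pow z k) - (zinv * z) * pow z k    ≈⟨ +-congˡ (-‿cong (trans (*-congʳ zinv*z≈1) (*-identityˡ _))) ⟩
    z * (z * pow z k) - pow z k                 ∎)

  -- The z-row of the numerator has the same shape as the x-rows.
  zRow-asDifference : ∀ z zinv → zinv * z ≈ 1# → ∀ e m → e ≡ suc m →
                      ipow z zinv (+ e) - ipow z zinv (+ e ℤ.- + 2) ≈ powDiff z zinv e - zinv * powDiff z zinv m
  zRow-asDifference z zinv zinv*z≈1 .(suc zero) zero P.refl =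
    solve 4 (λ a b w o → a :- b := (a :- b) :- w :* (o :- o)) refl _ _ zinv 1#
  zRow-asDifference z zinv zinv*z≈1 .(suc (suc m)) (suc m) P.refl = begin
    z * (z * pow z m) - pow z m
      ≈⟨ +-congˡ (-‿cong (sym (trans (*-congʳ zinv*z≈1) (*-identityˡ _)))) ⟩
    z * (z * pow z m) - (zinv * z) * pow z m
      ≈⟨ solve 4 (λ a b P Q → a :* (a :* P) :- (b :* a) :* P := (a :* (a :* P) :- b :* (b :* Q)) :- b :* (a :* P :- b :* Q))
                 refl z zinv _ _ ⟩
    (z * (z * pow z m) - zinv * (zinv * pow zinv m)) - zinv * (z * pow z m - zinv * pow zinv m) ∎

  xPairs : ∀ {n} → (Fin n → Carrier) → (Fin n → Carrier) → Pairs
  xPairs {zero}  x xinv = []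
  xPairs {suc n} x xinv = (x zero , xinv zero) ∷ xPairs (λ i → x (suc i)) (λ i → xinv (suc i))

  xPairsExcept : ∀ {n} → (Fin n → Carrier) → (Fin n → Carrier) → Fin n → Pairs
  xPairsExcept {suc n} x xinv zero    = xPairs (λ i → x (suc i)) (λ i → xinv (suc i))
  xPairsExcept {suc n} x xinv (suc r) = (x zero , xinv zero) ∷ xPairsExcept (λ i → x (suc i)) (λ i → xinv (suc i)) r

  length-xPairs : ∀ {n} x xinv → length (xPairs {n} x xinv) ≡ n
  length-xPairs {zero}  x xinv = P.refl
  length-xPairs {suc n} x xinv = P.cong suc (length-xPairs _ _)

  length-xPairsExcept : ∀ {n} x xinv (r : Fin n) → suc (length (xPairsExcept x xinv r)) ≡ n
  length-xPairsExcept {suc n} x xinv zero    = P.cong suc (length-xPairs _ _)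
  length-xPairsExcept {suc n} x xinv (suc r) = P.cong suc (length-xPairsExcept _ _ r)

  inverses-xPairs : ∀ {n} x xinv → (∀ i → x i * xinv i ≈ 1#) → Inverses (xPairs {n} x xinv)
  inverses-xPairs {zero}  x xinv x*xinv≈1 = _
  inverses-xPairs {suc n} x xinv x*xinv≈1 = x*xinv≈1 zero , inverses-xPairs _ _ (λ i → x*xinv≈1 (suc i))

  inverses-xPairsExcept : ∀ {n} x xinv → (∀ i → x i * xinv i ≈ 1#) → ∀ r → Inverses (xPairsExcept {n} x xinv r)
  inverses-xPairsExcept {suc n} x xinv x*xinv≈1 zero    = inverses-xPairs _ _ (λ i → x*xinv≈1 (suc i))
  inverses-xPairsExcept {suc n} x xinv x*xinv≈1 (suc r) = x*xinv≈1 zero , inverses-xPairsExcept _ _ (λ i → x*xinv≈1 (suc i)) r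

  removePairs-∷ : ∀ {ps L L′} a → RemovePairs ps L L′ → RemovePairs ps (a ∷ L) (a ∷ L′)
  removePairs-∷ a []              = []
  removePairs-∷ a ((ra , rb) ∷ rs) = (there ra , there rb) ∷ removePairs-∷ a rs

  removePairs-xPairs : ∀ {n} x xinv z → RemovePairs (xPairs {n} x xinv) (vars x xinv z) (z ∷ [])
  removePairs-xPairs {zero}  x xinv z = []
  removePairs-xPairs {suc n} x xinv z = (here , here) ∷ removePairs-∷ _ (removePairs-∷ _ (removePairs-xPairs _ _ z))

  removePairs-xPairsExcept : ∀ {n} x xinv z (r : Fin n) →
                             RemovePairs (xPairsExcept x xinv r) (vars x xinv z) (x r ∷ xinv r ∷ z ∷ [])
  removePairs-xPairsExcept {suc n} x xinv z zero    = removePairs-∷ _ (removePairs-∷ _ (removePairs-xPairs _ _ z))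
  removePairs-xPairsExcept {suc n} x xinv z (suc r) =
    (here , here) ∷ removePairs-∷ _ (removePairs-∷ _ (removePairs-xPairsExcept _ _ z r))

  -- The factorisation of the numerator

  module Factorisation (n : ℕ) (x xinv : Fin n → Carrier) (z zinv : Carrier)
                       (x*xinv≈1 : ∀ i → x i * xinv i ≈ 1#) (z*zinv≈1 : z * zinv ≈ 1#) where

    open JacobiTrudiSpan (hZ x xinv z)

    hZ≗hs : ∀ q → hZ x xinv z q ≈ hs (vars x xinv z) q
    hZ≗hs (+ k)    = refl
    hZ≗hs -[1+ k ] = refl

    RowCoefficients : (ℕ → Carrier) → Set (c ⊔ ℓ)
    RowCoefficients entry = Σ (Fin (suc n) → Carrier) λ coef → ∀ l t → t ℕ.≤ n →
                              entry (l ℕ.+ (n ℕ.∸ t)) ≈ sumF (λ k → coef k * jtEntry (toℕ k) (+ l ℤ.- + t))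

    cancelPairs : ∀ ps → length ps ≡ n → Inverses ps → (s : Carrier) (ψ : Seq) →
                  (∀ q → iterΔ ps (hs (vars x xinv z)) q ≈ ψ q) → RowCoefficients (λ e → s * ψ (+ e))
    cancelPairs ps P.refl inverses s ψ iterΔ≈ψ = (λ k → s * coef k) , λ l t t≤n → begin
      s * ψ (+ (l ℕ.+ (length ps ℕ.∸ t)))
        ≈⟨ *-congˡ (sym (trans (iterΔ≈ψ _) (≡⇒≈ (P.cong ψ (IndexArithmetic.l-t+n≡l+[n∸t] l t (length ps) t≤n))))) ⟩
      s * iterΔ ps (hs (vars x xinv z)) (+ l ℤ.- + t ℤ.+ + length ps)
        ≈⟨ *-congˡ (sym (trans (iterT-cong ps hZ≗hs _) (iterT-iterΔ ps inverses _ _))) ⟩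
      s * iterT ps (hZ x xinv z) (+ l ℤ.- + t)
        ≈⟨ *-congˡ (proj₂ (iterT-inSpan ps) _) ⟩
      s * sumF (λ k → coef k * jtEntry (toℕ k) (+ l ℤ.- + t))
        ≈⟨ sumF-distribˡ s (λ k → coef k * jtEntry (toℕ k) (+ l ℤ.- + t)) ⟩
      sumF (λ k → s * (coef k * jtEntry (toℕ k) (+ l ℤ.- + t)))
        ≈⟨ sumF-cong (λ k → sym (*-assoc s (coef k) (jtEntry (toℕ k) (+ l ℤ.- + t)))) ⟩
      sumF (λ k → s * coef k * jtEntry (toℕ k) (+ l ℤ.- + t)) ∎
      where
      coef : Fin (suc (length ps)) → Carrier
      coef = proj₁ (iterT-inSpan ps)

    -- The pair (z, z⁻¹) only removes z, since z⁻¹ is not a variable; Δ z⁻¹ survives.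
    xRowCoefficients : ∀ r → RowCoefficients (λ e → (x r - xinv r) * Δ zinv (hs (x r ∷ xinv r ∷ [])) (+ e))
    xRowCoefficients r =
      cancelPairs ((z , zinv) ∷ xPairsExcept x xinv r) (length-xPairsExcept x xinv r)
                  (z*zinv≈1 , inverses-xPairsExcept x xinv x*xinv≈1 r) (x r - xinv r) _
                  (λ q → trans (Δ-cong zinv (Δ-cong z (iterΔ-hs (removePairs-xPairsExcept x xinv z r))) q)
                               (Δ-cong zinv (Δ-hs (there (there here))) q))

    zRowCoefficients : RowCoefficients (λ e → (z - zinv) * hs (z ∷ []) (+ e))
    zRowCoefficients = cancelPairs (xPairs x xinv) (length-xPairs x xinv) (inverses-xPairs x xinv x*xinv≈1)
                                   (z - zinv) _ (iterΔ-hs (removePairs-xPairs x xinv z))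

    j≤n : (j : Fin (suc n)) → toℕ j ℕ.≤ n
    j≤n j = ℕ.s≤s⁻¹ (toℕ<n j)

    exponent : ∀ (la : Fin (suc n) → ℕ) j → la j ℕ.+ (n ℕ.∸ toℕ j) ℕ.+ 1 ≡ suc (la j ℕ.+ (n ℕ.∸ toℕ j))
    exponent la j = ℕₚ.+-comm _ 1

    rowCoefficients : (r : Fin (suc n)) → Σ (Fin (suc n) → Carrier) λ coef → ∀ la j →
                      matA n x xinv z zinv la r j ≈ sumF (λ k → coef k * jtEntry (toℕ k) (+ la j ℤ.- + toℕ j))
    rowCoefficients r with toℕ r ℕ.<? n
    ... | yes r<n = proj₁ xRow , λ la j →
      trans (xRowEntry (x r′) (xinv r′) zinv _ _ (exponent la j)) (proj₂ xRow (la j) (toℕ j) (j≤n j))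
      where
      r′ = Fin.fromℕ< r<n
      xRow = xRowCoefficients r′
    ... | no _ = proj₁ zRowCoefficients , λ la j →
      trans (zRowEntry z zinv (trans (*-comm _ _) z*zinv≈1) _ _ (exponent la j)) (proj₂ zRowCoefficients (la j) (toℕ j) (j≤n j))

    C : Mat (suc n)
    C r k = proj₁ (rowCoefficients r) k

    det-numerator : ∀ la → det (matA n x xinv z zinv la) ≈ det C * det (matJT n x xinv z la)
    det-numerator la = begin
      det (matA n x xinv z zinv la)
        ≈⟨ det-cong (λ r j → proj₂ (rowCoefficients r) la j) ⟩
      det (λ r j → sumF (λ k → C r k * jtEntry (toℕ k) (+ la j ℤ.- + toℕ j)))
        ≈⟨ det-cong (λ r j → sumF-cong {suc n} (λ k → *-congˡ {C r k} (jtEntry≡matJT j k))) ⟩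
      det (λ r j → sumF (λ k → C r k * matJT n x xinv z la j k))
        ≈⟨ det-product C (λ k j → matJT n x xinv z la j k) ⟩
      det C * det (λ k j → matJT n x xinv z la j k)
        ≈⟨ *-congˡ (det-transpose (matJT n x xinv z la)) ⟩
      det C * det (matJT n x xinv z la) ∎
      where
      jtEntry≡matJT : ∀ j k → jtEntry (toℕ k) (+ la j ℤ.- + toℕ j) ≈ matJT n x xinv z la j k
      jtEntry≡matJT j zero    = refl
      jtEntry≡matJT j (suc k) = refl

    det-jacobiTrudi-zero : det (matJT n x xinv z (λ _ → 0)) ≈ 1#
    det-jacobiTrudi-zero = trans (sym (det-transpose (matJT n x xinv z (λ _ → 0))))
                                 (det-lowerUnitriangular _ diagonal aboveDiagonal)
      where
      diagonal : ∀ i → matJT n x xinv z (λ _ → 0) i i ≈ 1#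
      diagonal zero    = hh-zero (vars x xinv z)
      diagonal (suc i) = trans (+-identityʳ _)
                               (trans (≡⇒≈ (P.cong (hZ x xinv z) (IndexArithmetic.-t+t≡0 (suc (toℕ i))))) (hh-zero (vars x xinv z)))
      aboveDiagonal : ∀ k j → toℕ k ℕ.< toℕ j → matJT n x xinv z (λ _ → 0) j k ≈ 0#
      aboveDiagonal zero    (suc j) _   = refl
      aboveDiagonal (suc k) (suc j) k<j with IndexArithmetic.s<t⇒-t+s<0 (suc (toℕ k)) (suc (toℕ j)) k<j
      ... | _ , negative = trans (+-identityʳ _) (≡⇒≈ (P.cong (hZ x xinv z) negative))

    -- b_{r,j} - z⁻¹ b_{r,j+1} is the j-th entry of row r of the numerator at λ = 0.
    U : Mat (suc n)
    U k j = δ (toℕ k) (toℕ j) - zinv * δ (toℕ k) (suc (toℕ j))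

    det-U : det U ≈ 1#
    det-U = det-lowerUnitriangular U diagonal aboveDiagonal
      where
      diagonal : ∀ i → U i i ≈ 1#
      diagonal i = begin
        δ (toℕ i) (toℕ i) - zinv * δ (toℕ i) (suc (toℕ i))
          ≈⟨ +-cong (δ-refl (toℕ i)) (-‿cong (*-congˡ (δ-≢ (toℕ i) (suc (toℕ i)) (ℕₚ.<⇒≢ (ℕₚ.n<1+n _))))) ⟩
        1# - zinv * 0#
          ≈⟨ solve 2 (λ o w → o :- w :* con (+ 0) := o) refl 1# zinv ⟩
        1# ∎
      aboveDiagonal : ∀ k j → toℕ k ℕ.< toℕ j → U k j ≈ 0#
      aboveDiagonal k j k<j = begin
        δ (toℕ k) (toℕ j) - zinv * δ (toℕ k) (suc (toℕ j))
          ≈⟨ +-cong (δ-≢ (toℕ k) (toℕ j) (ℕₚ.<⇒≢ k<j)) (-‿cong (*-congˡ (δ-≢ (toℕ k) (suc (toℕ j)) (ℕₚ.<⇒≢ (ℕₚ.m<n⇒m<1+n k<j))))) ⟩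
        0# - zinv * 0#
          ≈⟨ solve 1 (λ w → con (+ 0) :- w :* con (+ 0) := con (+ 0)) refl zinv ⟩
        0# ∎

    -- g(0) = 0 takes care of the missing entry b_{r,n+2} in the last column.
    sumF-*U : ∀ (g : ℕ → Carrier) → g 0 ≈ 0# → ∀ j →
              sumF (λ k → g ((n ℕ.∸ toℕ k) ℕ.+ 1) * U k j) ≈ g ((n ℕ.∸ toℕ j) ℕ.+ 1) - zinv * g (n ℕ.∸ toℕ j)
    sumF-*U g g0≈0 j = begin
      sumF {suc n} (λ k → F (toℕ k) * U k j)
        ≈⟨ sumF-cong {suc n} (λ k → solve 4 (λ f a w b → f :* (a :- w :* b) := a :* f :+ (:- (w :* (b :* f))))
                                    refl (F (toℕ k)) (δ (toℕ k) t) zinv (δ (toℕ k) (suc t))) ⟩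
      sumF {suc n} (λ k → δ (toℕ k) t * F (toℕ k) + - (zinv * (δ (toℕ k) (suc t) * F (toℕ k))))
        ≈⟨ sumF-+ {suc n} (λ k → δ (toℕ k) t * F (toℕ k)) (λ k → - (zinv * (δ (toℕ k) (suc t) * F (toℕ k)))) ⟩
      sumF {suc n} (λ k → δ (toℕ k) t * F (toℕ k)) + sumF {suc n} (λ k → - (zinv * (δ (toℕ k) (suc t) * F (toℕ k))))
        ≈⟨ +-cong (sumF-δ F t (toℕ<n j))
                  (trans (sym (sumF-neg {suc n} (λ k → zinv * (δ (toℕ k) (suc t) * F (toℕ k)))))
                         (-‿cong (sym (sumF-distribˡ {suc n} zinv (λ k → δ (toℕ k) (suc t) * F (toℕ k)))))) ⟩
      F t - zinv * sumF {suc n} (λ k → δ (toℕ k) (suc t) * F (toℕ k))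
        ≈⟨ +-congˡ (-‿cong (*-congˡ nextEntry)) ⟩
      F t - zinv * g (n ℕ.∸ t) ∎
      where
      t = toℕ j
      F : ℕ → Carrier
      F u = g ((n ℕ.∸ u) ℕ.+ 1)
      nextEntry : sumF {suc n} (λ k → δ (toℕ k) (suc t) * F (toℕ k)) ≈ g (n ℕ.∸ t)
      nextEntry with t ℕ.<? n
      ... | yes t<n = trans (sumF-δ F (suc t) (s≤s t<n))
                            (≡⇒≈ (P.cong g (P.trans (ℕₚ.+-comm (n ℕ.∸ suc t) 1) (P.sym (ℕₚ.+-∸-assoc 1 t<n)))))
      ... | no  t≮n = trans (sumF-δ-≥ F (suc t) (s≤s (ℕₚ.≮⇒≥ t≮n)))
                            (sym (trans (≡⇒≈ (P.cong g (ℕₚ.m≤n⇒m∸n≡0 (ℕₚ.≮⇒≥ t≮n)))) g0≈0))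

    numerator-zero : ∀ r j → matA n x xinv z zinv (λ _ → 0) r j ≈ sumF (λ k → matB n x xinv z zinv r k * U k j)
    numerator-zero r j with toℕ r ℕ.<? n
    ... | yes r<n = trans (+-congˡ (-‿cong (*-congˡ (powDiff-pred xi xinvi _ (n ℕ.∸ toℕ j) (ℕₚ.+-comm (n ℕ.∸ toℕ j) 1)))))
                          (sym (sumF-*U (powDiff xi xinvi) (-‿inverseʳ 1#) j))
      where
      xi    = x (Fin.fromℕ< r<n)
      xinvi = xinv (Fin.fromℕ< r<n)
    ... | no _ = trans (zRow-asDifference z zinv (trans (*-comm _ _) z*zinv≈1) _ (n ℕ.∸ toℕ j) (ℕₚ.+-comm (n ℕ.∸ toℕ j) 1))
                       (sym (sumF-*U (powDiff z zinv) (-‿inverseʳ 1#) j))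

    det-C : det C ≈ det (matB n x xinv z zinv)
    det-C = begin
      det C                                                          ≈⟨ *-identityʳ _ ⟨
      det C * 1#                                                     ≈⟨ *-congˡ det-jacobiTrudi-zero ⟨
      det C * det (matJT n x xinv z (λ _ → 0))                      ≈⟨ det-numerator (λ _ → 0) ⟨
      det (matA n x xinv z zinv (λ _ → 0))                          ≈⟨ det-cong numerator-zero ⟩
      det (λ r j → sumF (λ k → matB n x xinv z zinv r k * U k j))   ≈⟨ det-product (matB n x xinv z zinv) U ⟩
      det (matB n x xinv z zinv) * det U                            ≈⟨ trans (*-congˡ det-U) (*-identityʳ _) ⟩
      det (matB n x xinv z zinv)                                     ∎

    det-matA≈det-matB*det-matJT : ∀ la →
      det (matA n x xinv z zinv la) ≈ det (matB n x xinv z zinv) * det (matJT n x xinv z la)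
    det-matA≈det-matB*det-matJT la = trans (det-numerator la) (*-congʳ det-C)

mainTheorem5 : ∀ {c ℓ} (R : CommutativeRing c ℓ) →
    let open CommutativeRing R in
    let open WithRing R in
    (n : ℕ) (x xinv : Fin n → Carrier) (z zinv : Carrier) →
    (∀ i → x i * xinv i ≈ 1#) → z * zinv ≈ 1# →
    (la : Fin (suc n) → ℕ) → IsPartition la →
    (dinv : Carrier) → det (matB n x xinv z zinv) * dinv ≈ 1# →
    det (matA n x xinv z zinv la) * dinv ≈ det (matJT n x xinv z la)
mainTheorem5 R n x xinv z zinv x*xinv≈1 z*zinv≈1 la _ dinv detB*dinv≈1 = begin
  det A * dinv               ≈⟨ *-congʳ (Factorisation.det-matA≈det-matB*det-matJT R n x xinv z zinv x*xinv≈1 z*zinv≈1 la) ⟩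
  (det B * det JT) * dinv    ≈⟨ solve 3 (λ b j d → (b :* j) :* d := j :* (b :* d)) refl (det B) (det JT) dinv ⟩
  det JT * (det B * dinv)    ≈⟨ *-congˡ detB*dinv≈1 ⟩
  det JT * 1#                ≈⟨ *-identityʳ _ ⟩
  det JT                     ∎
  where
  open CommutativeRing R
  open WithRing R
  open IntegerCoefficientSolver R
  open import Relation.Binary.Reasoning.Setoid setoid
  A  = matA n x xinv z zinv la
  B  = matB n x xinv z zinv
  JT = matJT n x xinv z la
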